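{- Let $a,b$ be integers and let $(u_n)_{n\ge 0}$ be the integer sequence with $u_0=0$, $u_1=1$, $u_{n+2}=a u_{n+1}+b u_n$ for all $n\ge 0$, assumed nondegenerate ($b\neq 0$ and the ratio of the two complex roots of $x^2-ax-b$ is not a root of unity). Let $\Delta:=a^2+4b$. Let $k\ge 2$ be an integer with $\gcd(k,b)=1$, with prime factorization $k=p_1^{a_1}\cdots p_h^{a_h}$ ($p_1<\dots<p_h$ primes, $a_i\ge 1$). For each positive integer $n$ define $c_k(n):=\prod_{i=1}^h p_i^{\varrho_{p_i}(n)}$, where for a prime $p\nmid b$ the quantity $\varrho_p(n)$ is defined by $\varrho_2(n):=\nu_2(u_3)$ if $2\nmid\Delta$ and $2\nmid n$; $\varrho_2(n):=\nu_2(u_6)-1$ if $2\nmid \Delta$ and $2\mid n$; $\varrho_2(n):=\nu_2(u_2)-1$ if $2\mid\Delta$; and, for $p\ge 3$, $\varrho_p(n):=\nu_p(u_{\tau(p)})$ if $p\nmid\Delta$; $\varrho_p(n):=\nu_3(u_3)-1$ if $p\mid\Delta$ and $p=3$; $\varrho_p(n):=0$ if $p\mid\Delta$ and $p\ge 5$. Then for every positive integer $n$, $$\nu_k(u_n)=\begin{cases}\nu_k(c_k(n)\,n) & \text{if } \tau(p_1\cdots p_h)\mid n,\\ 0 & \text{if } \tau(p_1\cdots p_h)\nmid n.\end{cases}$$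
   Context: For integers $k\ge 2$ and $m\neq 0$, $\nu_k(m)$ denotes the greatest nonnegative integer $e$ such that $k^e\mid m$; for a prime $p$ this is the usual $p$-adic valuation. For a positive integer $m$ coprime to $b$, $\tau(m)$ (the rank of apparition of $m$) is the least positive integer $n$ with $m\mid u_n$. -}

module Defs where

open import Data.Nat using (ℕ; zero; suc; _≟_; _*_; _^_; _∸_; _≤_; _<_)
open import Data.Nat.Divisibility using (_∣_; _∣?_; divides)
open import Data.Nat.Primality using (prime?)
open import Data.Nat.Coprimality using (Coprime)
open import Data.Integer as ℤ using (ℤ; ∣_∣)
open import Data.Product using (_×_)
open import Data.Bool using (true; false; if_then_else_)
open import Relation.Nullary using (¬_; yes; no; does)
open import Relation.Nullary.Decidable using (_×-dec_)
open import Relation.Binary.PropositionalEquality using (_≡_; _≢_)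

u : ℤ → ℤ → ℕ → ℤ
u a b zero = ℤ.0ℤ
u a b (suc zero) = ℤ.1ℤ
u a b (suc (suc n)) = a ℤ.* u a b (suc n) ℤ.+ b ℤ.* u a b n

disc : ℤ → ℤ → ℤ
disc a b = a ℤ.* a ℤ.+ ℤ.+ 4 ℤ.* b

-- Nondegeneracy: b ≠ 0 and α/β is not a root of unity.  With α ≠ β (Δ ≠ 0)
-- and u_n = (α^n - β^n)/(α - β), "(α/β)^n ≠ 1 for all n ≥ 1" is
-- "u_n ≠ 0 for all n ≥ 1"; if Δ = 0 then α/β = 1 is a root of unity.
NonDegenerate : ℤ → ℤ → Set
NonDegenerate a b =
  (b ≢ ℤ.0ℤ) × (disc a b ≢ ℤ.0ℤ) × (∀ n → 1 ≤ n → u a b n ≢ ℤ.0ℤ)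

-- ν_k(m) for k ≥ 2, m ≠ 0 (natural numbers; applied to |m| for integers m):
-- the greatest e with k^e ∣ m, computed by repeated division with fuel m
-- (enough, since each step at least halves m).
νfuel : ℕ → ℕ → ℕ → ℕ
νfuel k zero m = 0
νfuel k (suc f) m with k ∣? m
... | yes (divides q _) = suc (νfuel k f q)
... | no _ = 0

ν : ℕ → ℕ → ℕ
ν k m = νfuel k m m

IsRank : ℤ → ℤ → ℕ → ℕ → Set
IsRank a b m t =
  (1 ≤ t) × (m ∣ ∣ u a b t ∣) × (∀ j → 1 ≤ j → j < t → ¬ (m ∣ ∣ u a b j ∣))

IsRankFn : ℤ → ℤ → (ℕ → ℕ) → Set
IsRankFn a b τ = ∀ m → 1 ≤ m → Coprime m ∣ b ∣ → IsRank a b m (τ m)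

primeProd : ℕ → (ℕ → ℕ) → ℕ → ℕ
primeProd k f zero = 1
primeProd k f (suc i) with does (prime? i ×-dec (i ∣? k))
... | true = f i * primeProd k f i
... | false = primeProd k f i

rad : ℕ → ℕ
rad k = primeProd k (λ p → p) (suc k)

ϱ : ℤ → ℤ → (ℕ → ℕ) → ℕ → ℕ → ℕ
ϱ a b τ p n =
  if does (p ≟ 2)
  then (if does (2 ∣? ∣ disc a b ∣)
        then ν 2 ∣ u a b 2 ∣ ∸ 1
        else (if does (2 ∣? n) then ν 2 ∣ u a b 6 ∣ ∸ 1 else ν 2 ∣ u a b 3 ∣))
  else (if does (p ∣? ∣ disc a b ∣)
        then (if does (p ≟ 3) then ν 3 ∣ u a b 3 ∣ ∸ 1 else 0)
        else ν p ∣ u a b (τ p) ∣)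

c : ℤ → ℤ → (ℕ → ℕ) → ℕ → ℕ → ℕ
c a b τ k n = primeProd k (λ p → p ^ ϱ a b τ p n) (suc k)

-- Fix a prime p ∤ b and write x = u_T, w = u_{T+1}. Expanding u_{mT} with the addition formula
-- gives w² u_{mT} ≡ m w^{m+1} x − C(m,2) a w^m x² (mod x³), and p ∤ w whenever p ∣ x. Hence, if
-- p^e ∥ u_T with e ≥ 1, then p^e ∥ u_{mT} for p ∤ m, and p^{e+1} ∥ u_{pT} as soon as the quadratic
-- term is negligible (p odd, p ∣ a, or e ≥ 2); iterating, ν_p(u_{mT}) = e + ν_p(m). For odd p ∤ Δ take T = τ(p), which is prime to p: p ∣ u_p
-- forces p ∣ Δ (expand (a + √Δ)^p in ℤ[√Δ]), and u_{sp}/u_s is a Lucas term of discriminant Δ u_s².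
-- For odd p ∣ Δ, τ(p) = p, and the expansion of a² 2^{p−1} u_p in powers of Δ gives ν_p(u_p) = 1
-- for p ≥ 5. For p = 2, T is 2, 3 or 6 according to the parities of Δ and n.
-- Finally, ν_k of two positive integers agree once their p-adic valuations agree for every prime
-- p ∣ k, and τ(rad k) ∣ n exactly when every prime factor of k divides u_n.

module Submission where

module Valuation where

  open import Data.List using ([]; _∷_)
  open import Data.List.Relation.Unary.All using (_∷_)
  open import Data.Nat
  open import Data.Nat.Properties
  open import Data.Nat.Divisibility
  open import Data.Nat.Induction using (<-rec)
  open import Data.Nat.Primality
  open import Data.Nat.Coprimality using (Coprime)
  open import Data.Nat.DivMod using (_%_; _/_; m≡m%n+[m/n]*n; m%n<n)
  open import Data.Nat.Primality.Factorisation using (factorise)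
  open import Data.Nat.Tactic.RingSolver using (solve-∀)
  open import Data.Product using (∃-syntax; _×_; _,_; map₂; swap)
  open import Data.Sum using (inj₁; inj₂)
  open import Relation.Nullary using (yes; no; contradiction)
  open import Relation.Binary.PropositionalEquality
  open import Defs using (ν; νfuel)

  prime>1 : ∀ {p} → Prime p → 1 < p
  prime>1 {p} p-prime = nonTrivial⇒n>1 p {{prime⇒nonTrivial p-prime}}

  ^-monoʳ-∣ : ∀ k {m n} → m ≤ n → k ^ m ∣ k ^ n
  ^-monoʳ-∣ k {m} {n} m≤n = subst (k ^ m ∣_)
    (trans (sym (^-distribˡ-+-* k m (n ∸ m))) (cong (k ^_) (m+[n∸m]≡n m≤n)))
    (m∣m*n (k ^ (n ∸ m)))

  prime∣^⇒∣ : ∀ {p k} j → Prime p → p ∣ k ^ j → p ∣ k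
  prime∣^⇒∣ zero    p-prime p∣1 = contradiction (∣1⇒≡1 p∣1) (>⇒≢ (prime>1 p-prime))
  prime∣^⇒∣ {k = k} (suc j) p-prime p∣k^j+1 with euclidsLemma k (k ^ j) p-prime p∣k^j+1
  ... | inj₁ p∣k   = p∣k
  ... | inj₂ p∣k^j = prime∣^⇒∣ j p-prime p∣k^j

  prime-power-divisor : ∀ {p n o} e → Prime p → p ∤ n → p ^ e ∣ n * o → p ^ e ∣ o
  prime-power-divisor {o = o} zero p-prime p∤n _ = 1∣ o
  prime-power-divisor {p} {n} {o} (suc e) p-prime p∤n p^e+1∣no
    with euclidsLemma n o p-prime (m*n∣⇒m∣ p (p ^ e) p^e+1∣no)
  ... | inj₁ p∣n = contradiction p∣n p∤n
  ... | inj₂ (divides o′ refl) =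
    subst (_∣ o′ * p) (*-comm (p ^ e) p) (*-monoˡ-∣ p (prime-power-divisor e p-prime p∤n p^e∣no′))
    where
    instance
      p≢0 : NonZero p
      p≢0 = prime⇒nonZero p-prime
    p^e∣no′ : p ^ e ∣ n * o′
    p^e∣no′ = *-cancelˡ-∣ p (subst (p * p ^ e ∣_) (trans (sym (*-assoc n o′ p)) (*-comm (n * o′) p)) p^e+1∣no)

  odd-prime>2 : ∀ {p} → Prime p → p ≢ 2 → 2 < p
  odd-prime>2 p-prime p≢2 = ≤∧≢⇒< (prime>1 p-prime) (≢-sym p≢2)

  odd-prime⇒≡2h+1 : ∀ {p} → Prime p → p ≢ 2 → ∃[ h ] p ≡ suc (h + h)
  odd-prime⇒≡2h+1 {p} p-prime p≢2 = go (p % 2) (p / 2) (m≡m%n+[m/n]*n p 2) (m%n<n p 2)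
    where
    go : ∀ r q → p ≡ r + q * 2 → r < 2 → ∃[ h ] p ≡ suc (h + h)
    go 0 q p≡2q _ with prime⇒irreducible p-prime (divides q p≡2q)
    ... | inj₁ ()
    ... | inj₂ 2≡p = contradiction (sym 2≡p) p≢2
    go 1 q p≡1+2q _ = q , trans p≡1+2q (cong suc (trans (*-comm q 2) (cong (q +_) (+-identityʳ q))))
    go (suc (suc _)) _ _ (s<s (s<s ()))

  prime∤⇒coprime : ∀ {p n} → Prime p → p ∤ n → Coprime p n
  prime∤⇒coprime p-prime p∤n (i∣p , i∣n) with prime⇒irreducible p-prime i∣p
  ... | inj₁ i≡1 = i≡1
  ... | inj₂ refl = contradiction i∣n p∤n

  prime∣prime⇒≡ : ∀ {p q} → Prime p → Prime q → p ∣ q → p ≡ q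
  prime∣prime⇒≡ p-prime q-prime p∣q with prime⇒irreducible q-prime p∣q
  ... | inj₁ p≡1 = contradiction p≡1 (>⇒≢ (prime>1 p-prime))
  ... | inj₂ p≡q = p≡q

  coprime-∣ : ∀ {m n d} → Coprime m n → d ∣ m → Coprime d n
  coprime-∣ m⊥n d∣m (i∣d , i∣n) = m⊥n (∣-trans i∣d d∣m , i∣n)

  prime-divisor : ∀ d → 1 < d → ∃[ p ] Prime p × p ∣ d
  prime-divisor d 1<d with factorise d {{>-nonZero (<-trans z<s 1<d)}}
  ... | record { factors = [] ; isFactorisation = d≡1 } = contradiction d≡1 (>⇒≢ 1<d)
  ... | record { factors = p ∷ ps ; isFactorisation = refl ; factorsPrime = p-prime ∷ _ } =
    p , p-prime , m∣m*n _

  infix 4 _^_∥_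

  record _^_∥_ (p e n : ℕ) : Set where
    constructor exactly
    field
      ∥⇒∣ : p ^ e ∣ n
      ∥⇒∤ : p ^ suc e ∤ n

  open _^_∥_ public

  ∤⇒^0∥ : ∀ {p n} → p ∤ n → p ^ 0 ∥ n
  ∤⇒^0∥ {p} {n} p∤n = exactly (1∣ n) (λ p^1∣n → p∤n (subst (_∣ n) (^-identityʳ p) p^1∣n))

  ^∥^ : ∀ {p} e → 1 < p → p ^ e ∥ p ^ e
  ^∥^ {p} e 1<p = exactly ∣-refl (>⇒∤ {{m^n≢0 p e {{>-nonZero (<-trans z<s 1<p)}}}} (^-monoʳ-< p 1<p (n<1+n e)))

  ∥-*-self : ∀ {k e n} → 0 < k → k ^ e ∥ n → k ^ suc e ∥ n * k
  ∥-*-self {k} {e} {n} 0<k (exactly k^e∣n k^e+1∤n) = exactly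
    (subst (_∣ n * k) (*-comm (k ^ e) k) (*-monoˡ-∣ k k^e∣n))
    (λ k^e+2∣nk → k^e+1∤n (*-cancelʳ-∣ k {{>-nonZero 0<k}} (subst (_∣ n * k) (*-comm k (k ^ suc e)) k^e+2∣nk)))

  ∥⇒≤ : ∀ {p e n j} → p ^ e ∥ n → p ^ j ∣ n → j ≤ e
  ∥⇒≤ {p} {e} {n} {j} p^e∥n p^j∣n with j ≤? e
  ... | yes j≤e = j≤e
  ... | no  j≰e = contradiction (∣-trans (^-monoʳ-∣ p (≰⇒> j≰e)) p^j∣n) (∥⇒∤ p^e∥n)

  ∥-unique : ∀ {p e f n} → p ^ e ∥ n → p ^ f ∥ n → e ≡ f
  ∥-unique p^e∥n p^f∥n = ≤-antisym (∥⇒≤ p^f∥n (∥⇒∣ p^e∥n)) (∥⇒≤ p^e∥n (∥⇒∣ p^f∥n))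

  ∥-cancelˡ : ∀ {p e m n} → Prime p → p ∤ m → p ^ e ∥ m * n → p ^ e ∥ n
  ∥-cancelˡ {e = e} {m} p-prime p∤m (exactly p^e∣mn p^e+1∤mn) =
    exactly (prime-power-divisor e p-prime p∤m p^e∣mn) (λ p^e+1∣n → p^e+1∤mn (∣n⇒∣m*n m p^e+1∣n))

  ∥⇒cofactor : ∀ {p e n} → p ^ e ∥ n → ∃[ r ] n ≡ r * p ^ e × p ∤ r
  ∥⇒cofactor {p} {e} (exactly (divides r n≡r*p^e) p^e+1∤n) = r , n≡r*p^e , p∤r
    where
    p∤r : p ∤ r
    p∤r (divides s refl) = p^e+1∤n (divides s (trans n≡r*p^e (*-assoc s p (p ^ e))))

  ∥-* : ∀ {p e f m n} → Prime p → p ^ e ∥ m → p ^ f ∥ n → p ^ (e + f) ∥ m * n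
  ∥-* {p} {e} {f} {m} {n} p-prime p^e∥m p^f∥n = exactly p^e+f∣mn p^e+f+1∤mn
    where
    p^e+f∣mn : p ^ (e + f) ∣ m * n
    p^e+f∣mn = subst (_∣ m * n) (sym (^-distribˡ-+-* p e f)) (*-pres-∣ (∥⇒∣ p^e∥m) (∥⇒∣ p^f∥n))
    p^e+f+1∤mn : p ^ suc (e + f) ∤ m * n
    p^e+f+1∤mn p^e+f+1∣mn with ∥⇒cofactor p^e∥m | ∥⇒cofactor p^f∥n
    ... | r , refl , p∤r | s , refl , p∤s with euclidsLemma r s p-prime p∣rs
      where
      instance
        p^[e+f]≢0 : NonZero (p ^ (e + f))
        p^[e+f]≢0 = m^n≢0 p (e + f) {{prime⇒nonZero p-prime}}
      interchange : ∀ r x s y → r * x * (s * y) ≡ x * y * (r * s)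
      interchange = solve-∀
      p∣rs : p ∣ r * s
      p∣rs = *-cancelˡ-∣ (p ^ (e + f)) (subst₂ _∣_ (*-comm p (p ^ (e + f)))
        (trans (interchange r (p ^ e) s (p ^ f)) (cong (_* (r * s)) (sym (^-distribˡ-+-* p e f))))
        p^e+f+1∣mn)
    ... | inj₁ p∣r = p∤r p∣r
    ... | inj₂ p∣s = p∤s p∣s

  νfuel-∥ : ∀ {k} f n → 1 < k → 0 < n → n ≤ f → k ^ νfuel k f n ∥ n
  νfuel-∥ zero n _ 0<n n≤0 = contradiction n≤0 (<⇒≱ 0<n)
  νfuel-∥ {k} (suc f) n 1<k 0<n n≤1+f with k ∣? n
  ... | no k∤n = ∤⇒^0∥ k∤n
  ... | yes (divides q refl) = ∥-*-self (<-trans z<s 1<k) (νfuel-∥ f q 1<k 0<q q≤f)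
    where
    0<q : 0 < q
    0<q = >-nonZero⁻¹ q {{m*n≢0⇒m≢0 q {{>-nonZero 0<n}}}}
    q≤f : q ≤ f
    q≤f = ≤-pred (≤-trans (m<m*n q k {{>-nonZero 0<q}} 1<k) n≤1+f)

  ν-∥ : ∀ {k n} → 1 < k → 0 < n → k ^ ν k n ∥ n
  ν-∥ {n = n} 1<k 0<n = νfuel-∥ n n 1<k 0<n ≤-refl

  ∥⇒ν≡ : ∀ {k e n} → 1 < k → 0 < n → k ^ e ∥ n → ν k n ≡ e
  ∥⇒ν≡ 1<k 0<n = ∥-unique (ν-∥ 1<k 0<n)

  ν≡0 : ∀ {k n} → 1 < k → 0 < n → k ∤ n → ν k n ≡ 0
  ν≡0 1<k 0<n k∤n = ∥⇒ν≡ 1<k 0<n (∤⇒^0∥ k∤n)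

  ν-* : ∀ {p m n} → Prime p → 0 < m → 0 < n → ν p (m * n) ≡ ν p m + ν p n
  ν-* p-prime 0<m 0<n = ∥⇒ν≡ (prime>1 p-prime) (*-mono-≤ 0<m 0<n)
    (∥-* p-prime (ν-∥ (prime>1 p-prime) 0<m) (ν-∥ (prime>1 p-prime) 0<n))

  ν-self : ∀ {p} → 1 < p → ν p p ≡ 1
  ν-self {p} 1<p = ∥⇒ν≡ 1<p (<-trans z<s 1<p) (subst (p ^ 1 ∥_) (^-identityʳ p) (^∥^ 1 1<p))

  ν[m*p]≡1+ν[m] : ∀ {p m} → Prime p → 0 < m → ν p (m * p) ≡ suc (ν p m)
  ν[m*p]≡1+ν[m] {p} {m} p-prime 0<m = begin
    ν p (m * p)     ≡⟨ ν-* p-prime 0<m (<-trans z<s (prime>1 p-prime)) ⟩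
    ν p m + ν p p   ≡⟨ cong (ν p m +_) (ν-self (prime>1 p-prime)) ⟩
    ν p m + 1       ≡⟨ +-comm (ν p m) 1 ⟩
    suc (ν p m)     ∎
    where open ≡-Reasoning

  ν[m*n]≡ν[m] : ∀ {p m n} → Prime p → 0 < m → 0 < n → p ∤ n → ν p (m * n) ≡ ν p m
  ν[m*n]≡ν[m] {p} {m} p-prime 0<m 0<n p∤n = trans (ν-* p-prime 0<m 0<n)
    (trans (cong (ν p m +_) (ν≡0 (prime>1 p-prime) 0<n p∤n)) (+-identityʳ (ν p m)))

  ∣⇒0<ν : ∀ {p n} → 1 < p → 0 < n → p ∣ n → 0 < ν p n
  ∣⇒0<ν {p} {n} 1<p 0<n p∣n = ∥⇒≤ (ν-∥ 1<p 0<n) (subst (_∣ n) (sym (^-identityʳ p)) p∣n)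

  ∣-from-prime-powers : ∀ {d n} → 0 < d → (∀ {p} i → Prime p → p ^ i ∣ d → p ^ i ∣ n) → d ∣ n
  ∣-from-prime-powers {d} {n} = <-rec P step d
    where
    P : ℕ → Set
    P d = 0 < d → (∀ {p} i → Prime p → p ^ i ∣ d → p ^ i ∣ n) → d ∣ n
    step : ∀ d → (∀ {d′} → d′ < d → P d′) → P d
    step 1 _ _ _ = 1∣ n
    step d@(2+ _) rec 0<d powers∣n
      with prime-divisor d (s≤s (s≤s z≤n))
    ... | p , p-prime , p∣d
      with ν-∥ (prime>1 p-prime) 0<d
    ... | p^i∥d with ∥⇒cofactor p^i∥d
    ... | r , d≡r*p^i , p∤r = subst (_∣ n) (sym d≡r*p^i) r*p^i∣n
      where
      i : ℕ
      i = ν p d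
      r∣d : r ∣ d
      r∣d = divides (p ^ i) (trans d≡r*p^i (*-comm r (p ^ i)))
      0<r : 0 < r
      0<r = >-nonZero⁻¹ r {{m*n≢0⇒m≢0 r {{subst NonZero d≡r*p^i _}}}}
      0<i : 0 < i
      0<i = ∣⇒0<ν (prime>1 p-prime) 0<d p∣d
      r<d : r < d
      r<d = subst (r <_) (sym d≡r*p^i)
        (m<m*n r (p ^ i) {{>-nonZero 0<r}} (^-monoʳ-< p (prime>1 p-prime) 0<i))
      r∣n : r ∣ n
      r∣n = rec r<d 0<r (λ j q-prime q^j∣r → powers∣n j q-prime (∣-trans q^j∣r r∣d))
      r*p^i∣n : r * p ^ i ∣ n
      r*p^i∣n with r∣n
      ... | divides s refl = subst (r * p ^ i ∣_) (*-comm r s) (*-monoʳ-∣ r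
        (prime-power-divisor i p-prime p∤r (subst (p ^ i ∣_) (*-comm s r) (powers∣n i p-prime (∥⇒∣ p^i∥d)))))

  ^∣-primewise : ∀ {k m n} → 1 < k →
    (∀ {p} → Prime p → p ∣ k → ∃[ e ] p ^ e ∥ m × p ^ e ∥ n) →
    ∀ j → k ^ j ∣ m → k ^ j ∣ n
  ^∣-primewise {k} {m} {n} 1<k agree j k^j∣m =
    ∣-from-prime-powers (m^n>0 k {{>-nonZero (<-trans z<s 1<k)}} j) transfer
    where
    transfer : ∀ {p} i → Prime p → p ^ i ∣ k ^ j → p ^ i ∣ n
    transfer zero        _       _         = 1∣ n
    transfer {p} (suc i) p-prime p^i∣k^j
      with agree p-prime (prime∣^⇒∣ j p-prime (∣-trans (m∣m*n (p ^ i)) p^i∣k^j))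
    ... | e , p^e∥m , p^e∥n =
      ∣-trans (^-monoʳ-∣ p (∥⇒≤ {j = suc i} p^e∥m (∣-trans p^i∣k^j k^j∣m))) (∥⇒∣ p^e∥n)

  ν-≡-primewise : ∀ {k m n} → 1 < k → 0 < m → 0 < n →
    (∀ {p} → Prime p → p ∣ k → ∃[ e ] p ^ e ∥ m × p ^ e ∥ n) → ν k m ≡ ν k n
  ν-≡-primewise {k} {m} {n} 1<k 0<m 0<n agree = ≤-antisym
    (∥⇒≤ (ν-∥ 1<k 0<n) (^∣-primewise 1<k agree (ν k m) (∥⇒∣ (ν-∥ 1<k 0<m))))
    (∥⇒≤ (ν-∥ 1<k 0<m) (^∣-primewise 1<k (λ p-prime p∣k → map₂ swap (agree p-prime p∣k))
      (ν k n) (∥⇒∣ (ν-∥ 1<k 0<n))))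

module AbsDivisibility where

  open import Data.Nat as ℕ using (zero; suc)
  import Data.Nat.Properties as ℕ
  open import Data.Nat.Divisibility
  open import Data.Nat.Primality using (Prime; euclidsLemma)
  open import Data.Integer as ℤ using (+_; ∣_∣; _+_; _-_; _*_)
  open import Data.Integer.Properties using (abs-*)
  import Data.Integer.Divisibility.Signed as Signed
  open import Data.Sum using (_⊎_; inj₁; inj₂)
  open import Relation.Binary.PropositionalEquality
  open Valuation

  private
    toSigned : ∀ {d} x → d ∣ ∣ x ∣ → + d Signed.∣ x
    toSigned {d} x = Signed.∣ᵤ⇒∣ {+ d} {x}

    fromSigned : ∀ {d} x → + d Signed.∣ x → d ∣ ∣ x ∣
    fromSigned {d} x = Signed.∣⇒∣ᵤ {+ d} {x}

  ∣-+ : ∀ {d} x y → d ∣ ∣ x ∣ → d ∣ ∣ y ∣ → d ∣ ∣ x + y ∣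
  ∣-+ x y d∣x d∣y = fromSigned (x + y) (Signed.∣m∣n⇒∣m+n (toSigned x d∣x) (toSigned y d∣y))

  ∣-− : ∀ {d} x y → d ∣ ∣ x ∣ → d ∣ ∣ y ∣ → d ∣ ∣ x - y ∣
  ∣-− x y d∣x d∣y = fromSigned (x - y) (Signed.∣m∣n⇒∣m-n (toSigned x d∣x) (toSigned y d∣y))

  ∣-+-cancelʳ : ∀ {d} x y → d ∣ ∣ x + y ∣ → d ∣ ∣ y ∣ → d ∣ ∣ x ∣
  ∣-+-cancelʳ x y d∣x+y d∣y = fromSigned x (Signed.∣m+n∣n⇒∣m (toSigned (x + y) d∣x+y) (toSigned y d∣y))

  ∣-+-cancelˡ : ∀ {d} x y → d ∣ ∣ x + y ∣ → d ∣ ∣ x ∣ → d ∣ ∣ y ∣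
  ∣-+-cancelˡ x y d∣x+y d∣x = fromSigned y (Signed.∣m+n∣m⇒∣n (toSigned (x + y) d∣x+y) (toSigned x d∣x))

  ∣-*ˡ : ∀ {d} x y → d ∣ ∣ y ∣ → d ∣ ∣ x * y ∣
  ∣-*ˡ x y d∣y = subst (_ ∣_) (sym (abs-* x y)) (∣n⇒∣m*n ∣ x ∣ d∣y)

  ∣-*ʳ : ∀ {d} x y → d ∣ ∣ x ∣ → d ∣ ∣ x * y ∣
  ∣-*ʳ x y d∣x = subst (_ ∣_) (sym (abs-* x y)) (∣m⇒∣m*n ∣ y ∣ d∣x)

  ∣-*-pres : ∀ {d e} x y → d ∣ ∣ x ∣ → e ∣ ∣ y ∣ → d ℕ.* e ∣ ∣ x * y ∣
  ∣-*-pres x y d∣x e∣y = subst (_ ∣_) (sym (abs-* x y)) (*-pres-∣ d∣x e∣y)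

  abs-^ : ∀ x n → ∣ x ℤ.^ n ∣ ≡ ∣ x ∣ ℕ.^ n
  abs-^ x zero    = refl
  abs-^ x (suc n) = trans (abs-* x (x ℤ.^ n)) (cong (∣ x ∣ ℕ.*_) (abs-^ x n))

  prime∣* : ∀ {p} x y → Prime p → p ∣ ∣ x * y ∣ → (p ∣ ∣ x ∣) ⊎ (p ∣ ∣ y ∣)
  prime∣* x y p-prime p∣xy = euclidsLemma ∣ x ∣ ∣ y ∣ p-prime (subst (_ ∣_) (abs-* x y) p∣xy)

  ∤-* : ∀ {p} x y → Prime p → p ∤ ∣ x ∣ → p ∤ ∣ y ∣ → p ∤ ∣ x * y ∣
  ∤-* x y p-prime p∤x p∤y p∣xy with prime∣* x y p-prime p∣xy
  ... | inj₁ p∣x = p∤x p∣x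
  ... | inj₂ p∣y = p∤y p∣y

  ∤-^ : ∀ {p} x → Prime p → p ∤ ∣ x ∣ → ∀ n → p ∤ ∣ x ℤ.^ n ∣
  ∤-^ x p-prime p∤x n p∣xⁿ = p∤x (prime∣^⇒∣ n p-prime (subst (_ ∣_) (abs-^ x n) p∣xⁿ))

  ∥-+ : ∀ {p e} x y → p ^ e ∥ ∣ x ∣ → p ℕ.^ suc e ∣ ∣ y ∣ → p ^ e ∥ ∣ x + y ∣
  ∥-+ {p} {e} x y p^e∥x p^e+1∣y = exactly
    (∣-+ x y (∥⇒∣ p^e∥x) (∣-trans (^-monoʳ-∣ p (ℕ.n≤1+n e)) p^e+1∣y))
    (λ p^e+1∣x+y → ∥⇒∤ p^e∥x (∣-+-cancelʳ x y p^e+1∣x+y p^e+1∣y))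

  ∥-*ᶻ : ∀ {p e f} x y → Prime p → p ^ e ∥ ∣ x ∣ → p ^ f ∥ ∣ y ∣ → p ^ (e ℕ.+ f) ∥ ∣ x * y ∣
  ∥-*ᶻ {p} x y p-prime p^e∥x p^f∥y = subst (p ^ _ ∥_) (sym (abs-* x y)) (∥-* p-prime p^e∥x p^f∥y)

  ∥-cancelˡᶻ : ∀ {p e} x y → Prime p → p ∤ ∣ x ∣ → p ^ e ∥ ∣ x * y ∣ → p ^ e ∥ ∣ y ∣
  ∥-cancelˡᶻ {p} x y p-prime p∤x p^e∥xy = ∥-cancelˡ p-prime p∤x (subst (p ^ _ ∥_) (abs-* x y) p^e∥xy)

module LucasSequence where

  open import Data.Nat as ℕ using (ℕ; zero; suc)
  import Data.Nat.Properties as ℕ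
  open import Data.Nat.Combinatorics using (_C_; nC1≡n; nCk+nC[k+1]≡[n+1]C[k+1])
  open import Data.Nat.Divisibility using (_∣_; divides)
  open import Data.Integer using (ℤ; +_; 0ℤ; 1ℤ; _+_; _-_; _*_; _^_; ∣_∣)
  open import Data.Integer.Properties using (pos-+; abs-*)
  open import Data.Integer.Tactic.RingSolver using (solve-∀)
  open import Data.Product using (∃-syntax; _×_; _,_)
  open import Relation.Binary.PropositionalEquality
  open ≡-Reasoning
  open import Defs using (u; disc)

  private
    +[1+m]C2 : ∀ m → + (suc m C 2) ≡ + (m C 2) + + m
    +[1+m]C2 m = trans (cong +_ pascal) (pos-+ (m C 2) m)
      where
      pascal : suc m C 2 ≡ m C 2 ℕ.+ m
      pascal = begin
        suc m C 2         ≡⟨ nCk+nC[k+1]≡[n+1]C[k+1] m 1 ⟨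
        m C 1 ℕ.+ m C 2   ≡⟨ cong (ℕ._+ m C 2) (nC1≡n m) ⟩
        m ℕ.+ m C 2       ≡⟨ ℕ.+-comm m (m C 2) ⟩
        m C 2 ℕ.+ m       ∎

    +[1+m]C3 : ∀ m → + (suc m C 3) ≡ + (m C 3) + + (m C 2)
    +[1+m]C3 m = trans (cong +_ (trans (sym (nCk+nC[k+1]≡[n+1]C[k+1] m 2)) (ℕ.+-comm (m C 2) (m C 3))))
                       (pos-+ (m C 3) (m C 2))

  module _ (a b : ℤ) where

    private
      U : ℕ → ℤ
      U = u a b

    u-+ : ∀ m n → U (suc (m ℕ.+ n)) ≡ U (suc m) * U (suc n) + b * U m * U n
    u-+ m zero = trans (cong (λ k → U (suc k)) (ℕ.+-identityʳ m)) (x≡x*1+y*0 (U (suc m)) (b * U m))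
      where
      x≡x*1+y*0 : ∀ x y → x ≡ x * 1ℤ + y * 0ℤ
      x≡x*1+y*0 = solve-∀
    u-+ m (suc zero) = trans (cong (λ k → U (suc k)) (ℕ.+-comm m 1)) (recurrence a b (U (suc m)) (U m))
      where
      recurrence : ∀ a b x y → a * x + b * y ≡ x * (a * 1ℤ + b * 0ℤ) + b * y * 1ℤ
      recurrence = solve-∀
    u-+ m (suc (suc n)) = begin
      U (suc (m ℕ.+ suc (suc n)))
        ≡⟨ cong (λ k → U (suc k)) (trans (ℕ.+-suc m (suc n)) (cong suc (ℕ.+-suc m n))) ⟩
      a * U (suc (suc (m ℕ.+ n))) + b * U (suc (m ℕ.+ n))
        ≡⟨ cong₂ (λ s t → a * s + b * t)
             (trans (cong (λ k → U (suc k)) (sym (ℕ.+-suc m n))) (u-+ m (suc n))) (u-+ m n) ⟩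
      a * (U (suc m) * U (suc (suc n)) + b * U m * U (suc n)) + b * (U (suc m) * U (suc n) + b * U m * U n)
        ≡⟨ combine a b (U (suc m)) (U m) (U (suc (suc n))) (U (suc n)) (U n) ⟩
      U (suc m) * U (suc (suc (suc n))) + b * U m * U (suc (suc n)) ∎
      where
      combine : ∀ a b x y v₂ v₁ v₀ →
        a * (x * v₂ + b * y * v₁) + b * (x * v₁ + b * y * v₀) ≡ x * (a * v₂ + b * v₁) + b * y * (a * v₁ + b * v₀)
      combine = solve-∀

    u-2 : U 2 ≡ a
    u-2 = a*1+b*0≡a a b
      where
      a*1+b*0≡a : ∀ a b → a * 1ℤ + b * 0ℤ ≡ a
      a*1+b*0≡a = solve-∀

    module Multiples (t : ℕ) where

      T : ℕ
      T = suc t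

      x w z : ℤ
      x = U T
      w = U (suc T)
      z = U t

      u-[1+m]T : ∀ m → U (suc m ℕ.* T) ≡ U (suc (m ℕ.* T)) * x + b * U (m ℕ.* T) * z
      u-[1+m]T m = trans (cong (λ k → U (suc k)) (ℕ.+-comm t (m ℕ.* T))) (u-+ (m ℕ.* T) t)

      u-[1+m]T+1 : ∀ m → U (suc (suc m ℕ.* T)) ≡ U (suc (m ℕ.* T)) * w + b * U (m ℕ.* T) * x
      u-[1+m]T+1 m = trans (cong (λ k → U (suc (suc k))) (ℕ.+-comm t (m ℕ.* T)))
                           (trans (cong (λ k → U (suc k)) (sym (ℕ.+-suc (m ℕ.* T) t))) (u-+ (m ℕ.* T) T))

      -- Multiplying by w² clears the negative powers of w in u_{mT} ≡ m w^{m−1} x − C(m,2) a w^{m−2} x² (mod x³).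
      u-mT-expansion : ∀ m → ∃[ K ] ∃[ L ]
        w * w * U (m ℕ.* T) ≡ + m * w ^ suc m * x - + (m C 2) * a * w ^ m * (x * x) + x * x * x * K
        × w * w * U (suc (m ℕ.* T)) ≡ w ^ suc (suc m) + + (m C 2) * b * w ^ m * (x * x) + x * x * x * L
      u-mT-expansion zero = 0ℤ , 0ℤ , base₀ w x a , base₁ w x b
        where
        base₀ : ∀ w x a → w * w * 0ℤ ≡ + 0 * (w * 1ℤ) * x - + 0 * a * 1ℤ * (x * x) + x * x * x * 0ℤ
        base₀ = solve-∀
        base₁ : ∀ w x b → w * w * 1ℤ ≡ w * (w * 1ℤ) + + 0 * b * 1ℤ * (x * x) + x * x * x * 0ℤ
        base₁ = solve-∀
      u-mT-expansion (suc m) with u-mT-expansion m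
      ... | K , L , eqX , eqY = K′ , L′ ,
        (begin
          w * w * U (suc m ℕ.* T)
            ≡⟨ cong (w * w *_) (u-[1+m]T m) ⟩
          w * w * (U (suc (m ℕ.* T)) * x + b * U (m ℕ.* T) * z)
            ≡⟨ distribX w x b z (U (m ℕ.* T)) (U (suc (m ℕ.* T))) ⟩
          x * (w * w * U (suc (m ℕ.* T))) + b * z * (w * w * U (m ℕ.* T))
            ≡⟨ cong₂ (λ p q → x * p + b * z * q) eqY eqX ⟩
          x * (w ^ suc (suc m) + C₂ * b * w ^ m * (x * x) + x * x * x * L)
            + b * z * (M * w ^ suc m * x - C₂ * a * w ^ m * (x * x) + x * x * x * K)
            ≡⟨ stepX a b x z (w ^ m) M C₂ K L ⟩
          (1ℤ + M) * w ^ suc (suc m) * x - (C₂ + M) * a * w ^ suc m * (x * x) + x * x * x * K′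
            ≡⟨ cong₂ (λ p q → p * w ^ suc (suc m) * x - q * a * w ^ suc m * (x * x) + x * x * x * K′)
                 (sym (pos-+ 1 m)) (sym (+[1+m]C2 m)) ⟩
          + suc m * w ^ suc (suc m) * x - + (suc m C 2) * a * w ^ suc m * (x * x) + x * x * x * K′ ∎) ,
        (begin
          w * w * U (suc (suc m ℕ.* T))
            ≡⟨ cong (w * w *_) (u-[1+m]T+1 m) ⟩
          w * w * (U (suc (m ℕ.* T)) * w + b * U (m ℕ.* T) * x)
            ≡⟨ distribY w x b (U (m ℕ.* T)) (U (suc (m ℕ.* T))) ⟩
          w * (w * w * U (suc (m ℕ.* T))) + b * x * (w * w * U (m ℕ.* T))
            ≡⟨ cong₂ (λ p q → w * p + b * x * q) eqY eqX ⟩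
          w * (w ^ suc (suc m) + C₂ * b * w ^ m * (x * x) + x * x * x * L)
            + b * x * (M * w ^ suc m * x - C₂ * a * w ^ m * (x * x) + x * x * x * K)
            ≡⟨ stepY a b x w (w ^ m) M C₂ K L ⟩
          w ^ suc (suc (suc m)) + (C₂ + M) * b * w ^ suc m * (x * x) + x * x * x * L′
            ≡⟨ cong (λ q → w ^ suc (suc (suc m)) + q * b * w ^ suc m * (x * x) + x * x * x * L′)
                 (sym (+[1+m]C2 m)) ⟩
          w ^ suc (suc (suc m)) + + (suc m C 2) * b * w ^ suc m * (x * x) + x * x * x * L′ ∎)
        where
        M C₂ K′ L′ : ℤ
        M  = + m
        C₂ = + (m C 2)
        K′ = w * K + C₂ * a * a * w ^ m - a * x * K + C₂ * b * w ^ m + x * L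
        L′ = w * L - C₂ * a * b * w ^ m + b * x * K
        distribX : ∀ w x b z X Y → w * w * (Y * x + b * X * z) ≡ x * (w * w * Y) + b * z * (w * w * X)
        distribX = solve-∀
        distribY : ∀ w x b X Y → w * w * (Y * w + b * X * x) ≡ w * (w * w * Y) + b * x * (w * w * X)
        distribY = solve-∀
        stepX : ∀ a b x z W M C K L →
          x * ((a * x + b * z) * ((a * x + b * z) * W) + C * b * W * (x * x) + x * x * x * L)
          + b * z * (M * ((a * x + b * z) * W) * x - C * a * W * (x * x) + x * x * x * K)
          ≡ (1ℤ + M) * ((a * x + b * z) * ((a * x + b * z) * W)) * x
            - (C + M) * a * ((a * x + b * z) * W) * (x * x)
            + x * x * x * ((a * x + b * z) * K + C * a * a * W - a * x * K + C * b * W + x * L)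
        stepX = solve-∀
        stepY : ∀ a b x w W M C K L →
          w * (w * (w * W) + C * b * W * (x * x) + x * x * x * L)
          + b * x * (M * (w * W) * x - C * a * W * (x * x) + x * x * x * K)
          ≡ w * (w * (w * W)) + (C + M) * b * (w * W) * (x * x)
            + x * x * x * (w * L - C * a * b * W + b * x * K)
        stepY = solve-∀

      a′ b′ : ℤ
      a′ = w + b * z
      b′ = b * (x * x - w * z)

      u-mT-recurrence : ∀ m → U (suc (suc m) ℕ.* T) ≡ a′ * U (suc m ℕ.* T) + b′ * U (m ℕ.* T)
      u-mT-recurrence m = begin
        U (suc (suc m) ℕ.* T)
          ≡⟨ u-[1+m]T (suc m) ⟩
        U (suc (suc m ℕ.* T)) * x + b * U (suc m ℕ.* T) * z
          ≡⟨ cong₂ (λ p q → p * x + b * q * z) (u-[1+m]T+1 m) (u-[1+m]T m) ⟩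
        (Y * w + b * X * x) * x + b * (Y * x + b * X * z) * z
          ≡⟨ regroup w x b z X Y ⟩
        a′ * (Y * x + b * X * z) + b′ * X
          ≡⟨ cong (λ q → a′ * q + b′ * X) (u-[1+m]T m) ⟨
        a′ * U (suc m ℕ.* T) + b′ * X ∎
        where
        X Y : ℤ
        X = U (m ℕ.* T)
        Y = U (suc (m ℕ.* T))
        regroup : ∀ w x b z X Y →
          (Y * w + b * X * x) * x + b * (Y * x + b * X * z) * z
          ≡ (w + b * z) * (Y * x + b * X * z) + b * (x * x - w * z) * X
        regroup = solve-∀

      u-mT≡u[T]*u′ : ∀ m → U (m ℕ.* T) ≡ x * u a′ b′ m
      u-mT≡u[T]*u′ zero = x*0≡0 x
        where
        x*0≡0 : ∀ x → 0ℤ ≡ x * 0ℤ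
        x*0≡0 = solve-∀
      u-mT≡u[T]*u′ (suc zero) = trans (cong U (ℕ.+-identityʳ T)) (x*1≡x x)
        where
        x*1≡x : ∀ x → x ≡ x * 1ℤ
        x*1≡x = solve-∀
      u-mT≡u[T]*u′ (suc (suc m)) = begin
        U (suc (suc m) ℕ.* T)
          ≡⟨ u-mT-recurrence m ⟩
        a′ * U (suc m ℕ.* T) + b′ * U (m ℕ.* T)
          ≡⟨ cong₂ (λ p q → a′ * p + b′ * q) (u-mT≡u[T]*u′ (suc m)) (u-mT≡u[T]*u′ m) ⟩
        a′ * (x * u a′ b′ (suc m)) + b′ * (x * u a′ b′ m)
          ≡⟨ factor x a′ b′ (u a′ b′ (suc m)) (u a′ b′ m) ⟩
        x * u a′ b′ (suc (suc m)) ∎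
        where
        factor : ∀ x a b p q → a * (x * p) + b * (x * q) ≡ x * (a * p + b * q)
        factor = solve-∀

      disc-multiple : disc a′ b′ ≡ disc a b * (x * x)
      disc-multiple = identity a b x z
        where
        identity : ∀ a b x z →
          ((a * x + b * z) + b * z) * ((a * x + b * z) + b * z) + + 4 * (b * (x * x - (a * x + b * z) * z))
          ≡ (a * a + + 4 * b) * (x * x)
        identity = solve-∀

    u-∣-u-* : ∀ t m → ∣ U t ∣ ∣ ∣ U (m ℕ.* t) ∣
    u-∣-u-* zero m rewrite ℕ.*-zeroʳ m = divides 0 refl
    u-∣-u-* (suc t) m = divides ∣ u a′ b′ m ∣
      (trans (cong ∣_∣ (u-mT≡u[T]*u′ m)) (trans (abs-* x (u a′ b′ m)) (ℕ.*-comm ∣ x ∣ ∣ u a′ b′ m ∣)))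
      where open Multiples t

    private
      Δ : ℤ
      Δ = disc a b

    -- From 2ⁿ u_{n+1} = Σₖ C(n+1, 2k+1) aⁿ⁻²ᵏ Δᵏ; the factor a² clears the negative power of a.
    a²2ⁿu-expansion : ∀ n → ∃[ H ]
      a * a * (+ 2) ^ n * U (suc n) ≡ + suc n * a ^ suc (suc n) + + (suc n C 3) * a ^ n * Δ + H * (Δ * Δ)
    a²2ⁿu-expansion zero = 0ℤ , base₀ a b
      where
      base₀ : ∀ a b → a * a * 1ℤ * 1ℤ
        ≡ + 1 * (a * (a * 1ℤ)) + + 0 * 1ℤ * (a * a + + 4 * b) + 0ℤ * ((a * a + + 4 * b) * (a * a + + 4 * b))
      base₀ = solve-∀
    a²2ⁿu-expansion (suc zero) = 0ℤ , base₁ a b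
      where
      base₁ : ∀ a b → a * a * (+ 2 * 1ℤ) * (a * 1ℤ + b * 0ℤ)
        ≡ + 2 * (a * (a * (a * 1ℤ))) + + 0 * (a * 1ℤ) * (a * a + + 4 * b) + 0ℤ * ((a * a + + 4 * b) * (a * a + + 4 * b))
      base₁ = solve-∀
    a²2ⁿu-expansion (suc (suc n)) with a²2ⁿu-expansion n | a²2ⁿu-expansion (suc n)
    ... | H₀ , eq₀ | H₁ , eq₁ = H , (begin
      a * a * (+ 2 * (+ 2 * P)) * (a * U (suc (suc n)) + b * U (suc n))
        ≡⟨ unfold a b P (U (suc n)) (U (suc (suc n))) ⟩
      + 2 * a * (a * a * (+ 2 * P) * U (suc (suc n))) + + 4 * b * (a * a * P * U (suc n))
        ≡⟨ cong₂ (λ p q → + 2 * a * p + + 4 * b * q) eq₁ eq₀ ⟩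
      + 2 * a * (+ suc (suc n) * a ^ suc (suc (suc n)) + + (suc (suc n) C 3) * a ^ suc n * Δ + H₁ * (Δ * Δ))
        + + 4 * b * (N * a ^ suc (suc n) + C₃ * A * Δ + H₀ * (Δ * Δ))
        ≡⟨ cong₂ (λ p q → + 2 * a * (p * a ^ suc (suc (suc n)) + q * a ^ suc n * Δ + H₁ * (Δ * Δ))
                            + + 4 * b * (N * a ^ suc (suc n) + C₃ * A * Δ + H₀ * (Δ * Δ)))
                 (pos-+ 1 (suc n)) (+[1+m]C3 (suc n)) ⟩
      + 2 * a * ((1ℤ + N) * (a * (a * (a * A))) + (C₃ + C₂) * (a * A) * Δ + H₁ * (Δ * Δ))
        + + 4 * b * (N * (a * (a * A)) + C₃ * A * Δ + H₀ * (Δ * Δ))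
        ≡⟨ collect a b A N C₃ C₂ H₀ H₁ ⟩
      (1ℤ + (1ℤ + N)) * (a * (a * (a * (a * A)))) + ((C₃ + C₂) + (C₂ + N)) * (a * (a * A)) * Δ + H * (Δ * Δ)
        ≡⟨ cong₂ (λ p q → p * a ^ suc (suc (suc (suc n))) + q * a ^ suc (suc n) * Δ + H * (Δ * Δ))
                 (sym (trans (pos-+ 1 (suc (suc n))) (cong (_+_ 1ℤ) (pos-+ 1 (suc n)))))
                 (sym (trans (+[1+m]C3 (suc (suc n))) (cong₂ _+_ (+[1+m]C3 (suc n)) (+[1+m]C2 (suc n))))) ⟩
      + suc (suc (suc n)) * a ^ suc (suc (suc (suc n))) + + (suc (suc (suc n)) C 3) * a ^ suc (suc n) * Δ
        + H * (Δ * Δ) ∎)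
      where
      P A N C₂ C₃ H : ℤ
      P = (+ 2) ^ n
      A = a ^ n
      N = + suc n
      C₂ = + (suc n C 2)
      C₃ = + (suc n C 3)
      H = + 2 * a * H₁ + C₃ * A + + 4 * b * H₀
      unfold : ∀ a b P V₁ V₂ → a * a * (+ 2 * (+ 2 * P)) * (a * V₂ + b * V₁)
        ≡ + 2 * a * (a * a * (+ 2 * P) * V₂) + + 4 * b * (a * a * P * V₁)
      unfold = solve-∀
      collect : ∀ a b A N C D H₀ H₁ →
        + 2 * a * ((1ℤ + N) * (a * (a * (a * A))) + (C + D) * (a * A) * (a * a + + 4 * b)
          + H₁ * ((a * a + + 4 * b) * (a * a + + 4 * b)))
        + + 4 * b * (N * (a * (a * A)) + C * A * (a * a + + 4 * b) + H₀ * ((a * a + + 4 * b) * (a * a + + 4 * b)))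
        ≡ (1ℤ + (1ℤ + N)) * (a * (a * (a * (a * A)))) + ((C + D) + (D + N)) * (a * (a * A)) * (a * a + + 4 * b)
          + (+ 2 * a * H₁ + C * A + + 4 * b * H₀) * ((a * a + + 4 * b) * (a * a + + 4 * b))
      collect = solve-∀

module Frobenius where

  open import Algebra.Bundles using (CommutativeSemiring)
  open import Data.Fin using (Fin; zero; suc; toℕ; fromℕ)
  open import Data.Fin.Properties using (toℕ-fromℕ)
  open import Data.Integer as ℤ using (ℤ; +_; 0ℤ; 1ℤ; _+_; _-_; _*_; ∣_∣)
  import Data.Integer.Properties as ℤ
  open import Data.Integer.Properties using (pos-+)
  open import Data.Integer.Tactic.RingSolver using (solve-∀)
  open import Data.Nat as ℕ using (ℕ; zero; suc; _<_; z<s; s<s)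
  import Data.Nat.Properties as ℕ
  import Data.Nat.Tactic.RingSolver as ℕ-Solver
  open import Data.Nat.Combinatorics using (_C_; nCn≡1; nC1≡n; nCk+nC[k+1]≡[n+1]C[k+1])
  open import Data.Nat.Divisibility
  open import Data.Nat.Primality
  open import Data.Product using (∃-syntax; _×_; _,_; proj₁; proj₂)
  open import Data.Sum using (inj₁; inj₂; [_,_]′)
  open import Function using (id)
  open import Relation.Nullary using (contradiction)
  open import Relation.Binary.PropositionalEquality
  open import Relation.Binary.PropositionalEquality.Properties using (isEquivalence)
  open import Algebra.Structures {A = ℤ × ℤ} _≡_ using (IsCommutativeMonoid)
  open import Algebra.Structures.Biased {A = ℤ × ℤ} _≡_ using (isCommutativeMonoidˡ; isCommutativeSemiringˡ)
  open import Algebra.Definitions {A = ℤ × ℤ} _≡_ using (Associative; Commutative; LeftIdentity; LeftZero; _DistributesOverʳ_)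
  open import Defs using (u; disc)
  open AbsDivisibility
  open Valuation using (prime∣^⇒∣; odd-prime⇒≡2h+1; odd-prime>2)

  [1+k]*[1+n]C[1+k]≡[1+n]*nCk : ∀ n k → suc k ℕ.* (suc n C suc k) ≡ suc n ℕ.* (n C k)
  [1+k]*[1+n]C[1+k]≡[1+n]*nCk zero    zero    = refl
  [1+k]*[1+n]C[1+k]≡[1+n]*nCk zero    (suc k) = ℕ.*-zeroʳ (suc (suc k))
  [1+k]*[1+n]C[1+k]≡[1+n]*nCk (suc n) zero    =
    trans (ℕ.+-identityʳ _) (trans (nC1≡n (suc (suc n))) (sym (ℕ.*-identityʳ (suc (suc n)))))
  [1+k]*[1+n]C[1+k]≡[1+n]*nCk (suc n) (suc k) = begin
    suc (suc k) ℕ.* (suc (suc n) C suc (suc k))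
      ≡⟨ cong (suc (suc k) ℕ.*_) (nCk+nC[k+1]≡[n+1]C[k+1] (suc n) (suc k)) ⟨
    suc (suc k) ℕ.* (suc n C suc k ℕ.+ suc n C suc (suc k))
      ≡⟨ split (suc n C suc k) (suc n C suc (suc k)) k ⟩
    suc n C suc k ℕ.+ (suc k ℕ.* (suc n C suc k) ℕ.+ suc (suc k) ℕ.* (suc n C suc (suc k)))
      ≡⟨ cong₂ (λ x y → suc n C suc k ℕ.+ (x ℕ.+ y))
           ([1+k]*[1+n]C[1+k]≡[1+n]*nCk n k) ([1+k]*[1+n]C[1+k]≡[1+n]*nCk n (suc k)) ⟩
    suc n C suc k ℕ.+ (suc n ℕ.* (n C k) ℕ.+ suc n ℕ.* (n C suc k))
      ≡⟨ cong (suc n C suc k ℕ.+_) (ℕ.*-distribˡ-+ (suc n) (n C k) (n C suc k)) ⟨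
    suc n C suc k ℕ.+ suc n ℕ.* (n C k ℕ.+ n C suc k)
      ≡⟨ cong (λ x → suc n C suc k ℕ.+ suc n ℕ.* x) (nCk+nC[k+1]≡[n+1]C[k+1] n k) ⟩
    suc n C suc k ℕ.+ suc n ℕ.* (suc n C suc k) ∎
    where
    open ≡-Reasoning
    split : ∀ x y k → suc (suc k) ℕ.* (x ℕ.+ y) ≡ x ℕ.+ (suc k ℕ.* x ℕ.+ suc (suc k) ℕ.* y)
    split = ℕ-Solver.solve-∀

  prime∣pCk : ∀ {p k} → Prime p → 0 < k → k < p → p ∣ p C k
  prime∣pCk {zero}  p-prime _ _ = contradiction p-prime ¬prime[0]
  prime∣pCk {suc n} {suc k} p-prime _ k<p
    with euclidsLemma (suc k) (suc n C suc k) p-prime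
           (divides (n C k) (trans ([1+k]*[1+n]C[1+k]≡[1+n]*nCk n k) (ℕ.*-comm (suc n) (n C k))))
  ... | inj₁ p∣k+1 = contradiction (∣⇒≤ p∣k+1) (ℕ.<⇒≱ k<p)
  ... | inj₂ p∣pCk = p∣pCk

  private
    ∣2s∣s-d⇒∣2d : ∀ {p} s d → p ∣ ∣ + 2 * s ∣ → p ∣ ∣ s - d ∣ → p ∣ ∣ + 2 * d ∣
    ∣2s∣s-d⇒∣2d {p} s d p∣2s p∣s-d = subst (λ z → p ∣ ∣ z ∣) (2s-2[s-d]≡2d s d)
      (∣-− (+ 2 * s) (+ 2 * (s - d)) p∣2s (∣-*ˡ (+ 2) (s - d) p∣s-d))
      where
      2s-2[s-d]≡2d : ∀ s d → + 2 * s - + 2 * (s - d) ≡ + 2 * d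
      2s-2[s-d]≡2d = solve-∀

  module QuadraticRing (D : ℤ) where

    -- (x , y) stands for x + y √D.

    infixl 6 _⊕_
    infixl 7 _⊗_

    _⊕_ _⊗_ : ℤ × ℤ → ℤ × ℤ → ℤ × ℤ
    (x₀ , x₁) ⊕ (y₀ , y₁) = (x₀ + y₀ , x₁ + y₁)
    (x₀ , x₁) ⊗ (y₀ , y₁) = (x₀ * y₀ + D * (x₁ * y₁) , x₀ * y₁ + x₁ * y₀)

    private
      0# 1# : ℤ × ℤ
      0# = (0ℤ , 0ℤ)
      1# = (1ℤ , 0ℤ)

      ⊕-assoc : Associative _⊕_
      ⊕-assoc (x₀ , x₁) (y₀ , y₁) (z₀ , z₁) = cong₂ _,_ (ℤ.+-assoc x₀ y₀ z₀) (ℤ.+-assoc x₁ y₁ z₁)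

      ⊕-comm : Commutative _⊕_
      ⊕-comm (x₀ , x₁) (y₀ , y₁) = cong₂ _,_ (ℤ.+-comm x₀ y₀) (ℤ.+-comm x₁ y₁)

      ⊕-identityˡ : LeftIdentity 0# _⊕_
      ⊕-identityˡ (x₀ , x₁) = cong₂ _,_ (ℤ.+-identityˡ x₀) (ℤ.+-identityˡ x₁)

      ⊗-assoc : Associative _⊗_
      ⊗-assoc (x₀ , x₁) (y₀ , y₁) (z₀ , z₁) =
        cong₂ _,_ (assoc₀ D x₀ x₁ y₀ y₁ z₀ z₁) (assoc₁ D x₀ x₁ y₀ y₁ z₀ z₁)
        where
        assoc₀ : ∀ D x₀ x₁ y₀ y₁ z₀ z₁ →
          (x₀ * y₀ + D * (x₁ * y₁)) * z₀ + D * ((x₀ * y₁ + x₁ * y₀) * z₁)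
          ≡ x₀ * (y₀ * z₀ + D * (y₁ * z₁)) + D * (x₁ * (y₀ * z₁ + y₁ * z₀))
        assoc₀ = solve-∀
        assoc₁ : ∀ D x₀ x₁ y₀ y₁ z₀ z₁ →
          (x₀ * y₀ + D * (x₁ * y₁)) * z₁ + (x₀ * y₁ + x₁ * y₀) * z₀
          ≡ x₀ * (y₀ * z₁ + y₁ * z₀) + x₁ * (y₀ * z₀ + D * (y₁ * z₁))
        assoc₁ = solve-∀

      ⊗-comm : Commutative _⊗_
      ⊗-comm (x₀ , x₁) (y₀ , y₁) = cong₂ _,_ (comm₀ D x₀ x₁ y₀ y₁) (comm₁ x₀ x₁ y₀ y₁)
        where
        comm₀ : ∀ D x₀ x₁ y₀ y₁ → x₀ * y₀ + D * (x₁ * y₁) ≡ y₀ * x₀ + D * (y₁ * x₁)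
        comm₀ = solve-∀
        comm₁ : ∀ x₀ x₁ y₀ y₁ → x₀ * y₁ + x₁ * y₀ ≡ y₀ * x₁ + y₁ * x₀
        comm₁ = solve-∀

      ⊗-identityˡ : LeftIdentity 1# _⊗_
      ⊗-identityˡ (x₀ , x₁) = cong₂ _,_ (identity₀ D x₀ x₁) (identity₁ x₀ x₁)
        where
        identity₀ : ∀ D x₀ x₁ → 1ℤ * x₀ + D * (0ℤ * x₁) ≡ x₀
        identity₀ = solve-∀
        identity₁ : ∀ x₀ x₁ → 1ℤ * x₁ + 0ℤ * x₀ ≡ x₁
        identity₁ = solve-∀

      ⊗-zeroˡ : LeftZero 0# _⊗_
      ⊗-zeroˡ (x₀ , x₁) = cong₂ _,_ (zero₀ D x₀ x₁) (zero₁ x₀ x₁)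
        where
        zero₀ : ∀ D x₀ x₁ → 0ℤ * x₀ + D * (0ℤ * x₁) ≡ 0ℤ
        zero₀ = solve-∀
        zero₁ : ∀ x₀ x₁ → 0ℤ * x₁ + 0ℤ * x₀ ≡ 0ℤ
        zero₁ = solve-∀

      ⊗-distribʳ-⊕ : _⊗_ DistributesOverʳ _⊕_
      ⊗-distribʳ-⊕ (x₀ , x₁) (y₀ , y₁) (z₀ , z₁) =
        cong₂ _,_ (distrib₀ D x₀ x₁ y₀ y₁ z₀ z₁) (distrib₁ x₀ x₁ y₀ y₁ z₀ z₁)
        where
        distrib₀ : ∀ D x₀ x₁ y₀ y₁ z₀ z₁ →
          (y₀ + z₀) * x₀ + D * ((y₁ + z₁) * x₁) ≡ (y₀ * x₀ + D * (y₁ * x₁)) + (z₀ * x₀ + D * (z₁ * x₁))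
        distrib₀ = solve-∀
        distrib₁ : ∀ x₀ x₁ y₀ y₁ z₀ z₁ →
          (y₀ + z₀) * x₁ + (y₁ + z₁) * x₀ ≡ (y₀ * x₁ + y₁ * x₀) + (z₀ * x₁ + z₁ * x₀)
        distrib₁ = solve-∀

      isCommutativeMonoid : ∀ {_∙_ ε} → Associative _∙_ → LeftIdentity ε _∙_ → Commutative _∙_ →
                            IsCommutativeMonoid _∙_ ε
      isCommutativeMonoid {_∙_} assoc identityˡ comm = isCommutativeMonoidˡ record
        { isSemigroup = record { isMagma = record { isEquivalence = isEquivalence ; ∙-cong = cong₂ _∙_ } ; assoc = assoc }
        ; identityˡ = identityˡ
        ; comm = comm }

    commutativeSemiring : CommutativeSemiring _ _
    commutativeSemiring = record
      { _+_ = _⊕_ ; _*_ = _⊗_ ; 0# = 0# ; 1# = 1#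
      ; isCommutativeSemiring = isCommutativeSemiringˡ record
          { +-isCommutativeMonoid = isCommutativeMonoid ⊕-assoc ⊕-identityˡ ⊕-comm
          ; *-isCommutativeMonoid = isCommutativeMonoid ⊗-assoc ⊗-identityˡ ⊗-comm
          ; distribʳ = ⊗-distribʳ-⊕
          ; zeroˡ = ⊗-zeroˡ } }

  module _ (a b : ℤ) where

    private
      Δ : ℤ
      Δ = disc a b

    open QuadraticRing Δ
    open CommutativeSemiring commutativeSemiring using (rawSemiring; +-rawMonoid)
    open import Algebra.Properties.CommutativeSemiring.Binomial commutativeSemiring using (theorem)
    open import Algebra.Definitions.RawSemiring rawSemiring using (_^_)
    open import Algebra.Definitions.RawMonoid +-rawMonoid using (sum) renaming (_×_ to _·_)

    private
      √Δ â : ℤ × ℤ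
      √Δ = (0ℤ , 1ℤ)
      â  = (a , 0ℤ)

      proj₂-· : ∀ n z → proj₂ (n · z) ≡ + n * proj₂ z
      proj₂-· zero    z = refl
      proj₂-· (suc n) z = begin
        proj₂ z + proj₂ (n · z)   ≡⟨ cong (_+_ (proj₂ z)) (proj₂-· n z) ⟩
        proj₂ z + + n * proj₂ z   ≡⟨ x+nx≡[1+n]x (proj₂ z) (+ n) ⟩
        (1ℤ + + n) * proj₂ z      ≡⟨ cong (_* proj₂ z) (pos-+ 1 n) ⟨
        + suc n * proj₂ z         ∎
        where
        open ≡-Reasoning
        x+nx≡[1+n]x : ∀ x n → x + n * x ≡ (1ℤ + n) * x
        x+nx≡[1+n]x = solve-∀

      proj₂-â^ : ∀ n → proj₂ (â ^ n) ≡ 0ℤ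
      proj₂-â^ zero    = refl
      proj₂-â^ (suc n) =
        trans (cong (λ y → a * y + 0ℤ * proj₁ (â ^ n)) (proj₂-â^ n)) (a*0+0*y≡0 a (proj₁ (â ^ n)))
        where
        a*0+0*y≡0 : ∀ a y → a * 0ℤ + 0ℤ * y ≡ 0ℤ
        a*0+0*y≡0 = solve-∀

      √Δ^[2h] : ∀ h → √Δ ^ (h ℕ.+ h) ≡ (Δ ℤ.^ h , 0ℤ)
      √Δ^[2h] zero    = refl
      √Δ^[2h] (suc h) = begin
        √Δ ^ suc (h ℕ.+ suc h)       ≡⟨ cong (λ n → √Δ ^ suc n) (ℕ.+-suc h h) ⟩
        √Δ ⊗ (√Δ ⊗ √Δ ^ (h ℕ.+ h))   ≡⟨ cong (λ z → √Δ ⊗ (√Δ ⊗ z)) (√Δ^[2h] h) ⟩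
        √Δ ⊗ (√Δ ⊗ (Δ ℤ.^ h , 0ℤ))   ≡⟨ cong₂ _,_ (square₀ Δ (Δ ℤ.^ h)) (square₁ Δ (Δ ℤ.^ h)) ⟩
        (Δ ℤ.^ suc h , 0ℤ)           ∎
        where
        open ≡-Reasoning
        square₀ : ∀ D x → 0ℤ * (0ℤ * x + D * (1ℤ * 0ℤ)) + D * (1ℤ * (0ℤ * 0ℤ + 1ℤ * x)) ≡ D * x
        square₀ = solve-∀
        square₁ : ∀ D x → 0ℤ * (0ℤ * 0ℤ + 1ℤ * x) + 1ℤ * (0ℤ * x + D * (1ℤ * 0ℤ)) ≡ 0ℤ
        square₁ = solve-∀

      proj₂-√Δ^[2h+1] : ∀ h → proj₂ (√Δ ^ suc (h ℕ.+ h)) ≡ Δ ℤ.^ h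
      proj₂-√Δ^[2h+1] h = trans (cong (λ z → proj₂ (√Δ ⊗ z)) (√Δ^[2h] h)) (0*0+1*x≡x (Δ ℤ.^ h))
        where
        0*0+1*x≡x : ∀ x → 0ℤ * 0ℤ + 1ℤ * x ≡ x
        0*0+1*x≡x = solve-∀

    -- (a + √Δ)/2 is a root of x² − a x − b.
    2*[√Δ+a]^n : ∀ n → + 2 * proj₁ ((√Δ ⊕ â) ^ n) ≡ (+ 2) ℤ.^ n * (+ 2 * u a b (suc n) - a * u a b n)
                     × + 2 * proj₂ ((√Δ ⊕ â) ^ n) ≡ (+ 2) ℤ.^ n * u a b n
    2*[√Δ+a]^n zero    = base₀ a , base₁
      where
      base₀ : ∀ a → + 2 * 1ℤ ≡ 1ℤ * (+ 2 * 1ℤ - a * 0ℤ)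
      base₀ = solve-∀
      base₁ : + 2 * 0ℤ ≡ 1ℤ * 0ℤ
      base₁ = solve-∀
    2*[√Δ+a]^n (suc n) with 2*[√Δ+a]^n n
    ... | eq₀ , eq₁ =
      trans (unfold₀ a Δ r s) (trans (cong₂ (λ x y → a * x + Δ * y) eq₀ eq₁) (step₀ a b P (u a b n) (u a b (suc n)))) ,
      trans (unfold₁ a r s) (trans (cong₂ (λ x y → a * x + y) eq₁ eq₀) (step₁ a P (u a b n) (u a b (suc n))))
      where
      P r s : ℤ
      P = (+ 2) ℤ.^ n
      r = proj₁ ((√Δ ⊕ â) ^ n)
      s = proj₂ ((√Δ ⊕ â) ^ n)
      unfold₀ : ∀ a D r s → + 2 * ((0ℤ + a) * r + D * ((1ℤ + 0ℤ) * s)) ≡ a * (+ 2 * r) + D * (+ 2 * s)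
      unfold₀ = solve-∀
      unfold₁ : ∀ a r s → + 2 * ((0ℤ + a) * s + (1ℤ + 0ℤ) * r) ≡ a * (+ 2 * s) + + 2 * r
      unfold₁ = solve-∀
      step₀ : ∀ a b P u₀ u₁ → a * (P * (+ 2 * u₁ - a * u₀)) + (a * a + + 4 * b) * (P * u₀)
                              ≡ (+ 2 * P) * (+ 2 * (a * u₁ + b * u₀) - a * u₁)
      step₀ = solve-∀
      step₁ : ∀ a P u₀ u₁ → a * (P * u₀) + P * (+ 2 * u₁ - a * u₀) ≡ (+ 2 * P) * u₁
      step₁ = solve-∀

    private
      proj₂-sum-∣ : ∀ {q} m (g : Fin (suc m) → ℤ × ℤ) → (∀ i → toℕ i < m → q ∣ ∣ proj₂ (g i) ∣) →
                    q ∣ ∣ proj₂ (sum g) - proj₂ (g (fromℕ m)) ∣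
      proj₂-sum-∣ {q} zero g _ = subst (q ∣_) (cong ∣_∣ (sym (x+0-x≡0 (proj₂ (g zero))))) (q ∣0)
        where
        x+0-x≡0 : ∀ x → x + 0ℤ - x ≡ 0ℤ
        x+0-x≡0 = solve-∀
      proj₂-sum-∣ (suc m) g q∣g = subst (λ z → _ ∣ ∣ z ∣) (sym (+-assoc-− x y z))
        (∣-+ x (y - z) (q∣g zero z<s) (proj₂-sum-∣ m (λ i → g (suc i)) (λ i i<m → q∣g (suc i) (s<s i<m))))
        where
        x y z : ℤ
        x = proj₂ (g zero)
        y = proj₂ (sum (λ i → g (suc i)))
        z = proj₂ (g (suc (fromℕ m)))
        +-assoc-− : ∀ x y z → x + y - z ≡ x + (y - z)
        +-assoc-− = solve-∀

    module _ {p h} (p-prime : Prime p) (p≡2h+1 : p ≡ suc (h ℕ.+ h)) where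

      private
        term : ℕ → ℤ × ℤ
        term k = (p C k) · (√Δ ^ k ⊗ â ^ (p ℕ.∸ k))

        p∣term : ∀ k → k < p → p ∣ ∣ proj₂ (term k) ∣
        p∣term zero    _   = subst (λ z → p ∣ ∣ z ∣) (sym proj₂-term₀≡0) (p ∣0)
          where
          1*y+0*x≡y : ∀ x y → 1ℤ * y + 0ℤ * x ≡ y
          1*y+0*x≡y = solve-∀
          1*0≡0 : + 1 * 0ℤ ≡ 0ℤ
          1*0≡0 = solve-∀
          proj₂-term₀≡0 : proj₂ (term 0) ≡ 0ℤ
          proj₂-term₀≡0 = trans (proj₂-· 1 ((1ℤ , 0ℤ) ⊗ â ^ p))
            (trans (cong (+ 1 *_) (trans (1*y+0*x≡y (proj₁ (â ^ p)) (proj₂ (â ^ p))) (proj₂-â^ p))) 1*0≡0)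
        p∣term (suc k) k<p = subst (λ z → p ∣ ∣ z ∣) (sym (proj₂-· (p C suc k) _))
          (∣-*ʳ (+ (p C suc k)) _ (prime∣pCk p-prime z<s k<p))

        proj₂-term[p] : proj₂ (term p) ≡ Δ ℤ.^ h
        proj₂-term[p] = begin
          proj₂ ((p C p) · (√Δ ^ p ⊗ â ^ (p ℕ.∸ p)))
            ≡⟨ cong₂ (λ c n → proj₂ (c · (√Δ ^ p ⊗ â ^ n))) (nCn≡1 p) (ℕ.n∸n≡0 p) ⟩
          proj₂ (1 · (√Δ ^ p ⊗ (1ℤ , 0ℤ)))
            ≡⟨ trans (proj₂-· 1 (√Δ ^ p ⊗ (1ℤ , 0ℤ))) (1*[x*0+y*1]≡y (proj₁ (√Δ ^ p)) (proj₂ (√Δ ^ p))) ⟩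
          proj₂ (√Δ ^ p)
            ≡⟨ cong (λ n → proj₂ (√Δ ^ n)) p≡2h+1 ⟩
          proj₂ (√Δ ^ suc (h ℕ.+ h))
            ≡⟨ proj₂-√Δ^[2h+1] h ⟩
          Δ ℤ.^ h ∎
          where
          open ≡-Reasoning
          1*[x*0+y*1]≡y : ∀ x y → + 1 * (x * 0ℤ + y * 1ℤ) ≡ y
          1*[x*0+y*1]≡y = solve-∀

      p∣proj₂[√Δ+a]^p-Δ^h : p ∣ ∣ proj₂ ((√Δ ⊕ â) ^ p) - Δ ℤ.^ h ∣
      p∣proj₂[√Δ+a]^p-Δ^h = subst (λ z → p ∣ ∣ z ∣)
        (cong₂ (λ x y → proj₂ x - y) (sym (theorem p √Δ â))
               (trans (cong (λ k → proj₂ (term k)) (toℕ-fromℕ p)) proj₂-term[p]))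
        (proj₂-sum-∣ p (λ k → term (toℕ k)) (λ k → p∣term (toℕ k)))

    odd-prime∣u⇒∣disc : ∀ {p} → Prime p → p ≢ 2 → p ∣ ∣ u a b p ∣ → p ∣ ∣ Δ ∣
    odd-prime∣u⇒∣disc {p} p-prime p≢2 p∣u with odd-prime⇒≡2h+1 p-prime p≢2
    ... | h , p≡2h+1 = prime∣^⇒∣ h p-prime (subst (p ∣_) (abs-^ Δ h) p∣Δ^h)
      where
      s : ℤ
      s = proj₂ ((√Δ ⊕ â) ^ p)
      p∣2s : p ∣ ∣ + 2 * s ∣
      p∣2s = subst (λ z → p ∣ ∣ z ∣) (sym (proj₂ (2*[√Δ+a]^n p))) (∣-*ˡ ((+ 2) ℤ.^ p) (u a b p) p∣u)
      p∣2Δ^h : p ∣ ∣ + 2 * Δ ℤ.^ h ∣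
      p∣2Δ^h = ∣2s∣s-d⇒∣2d s (Δ ℤ.^ h) p∣2s (p∣proj₂[√Δ+a]^p-Δ^h {h = h} p-prime p≡2h+1)
      p∣Δ^h : p ∣ ∣ Δ ℤ.^ h ∣
      p∣Δ^h = [ (λ p∣2 → contradiction p∣2 (>⇒∤ (odd-prime>2 p-prime p≢2))) , id ]′
                (prime∣* (+ 2) (Δ ℤ.^ h) p-prime p∣2Δ^h)

module Apparition where

  open import Data.Nat as ℕ using (ℕ; zero; suc; _<_; z<s)
  import Data.Nat.Properties as ℕ
  open import Data.Nat.Coprimality using (Coprime; coprime-divisor)
  open import Data.Nat.DivMod using (_%_; _/_; m≡m%n+[m/n]*n; m%n<n)
  open import Data.Nat.Divisibility
  open import Data.Integer using (ℤ; _+_; _*_; ∣_∣)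
  open import Data.Integer.Properties using (abs-*)
  open import Data.Product using (_,_)
  open import Relation.Nullary using (contradiction)
  open import Relation.Binary.PropositionalEquality
  open import Defs using (u; IsRank)
  open Valuation using (coprime-∣)
  open AbsDivisibility
  open LucasSequence

  module _ (a b : ℤ) where

    private
      U : ℕ → ℤ
      U = u a b

    coprime-consecutive : ∀ {d} n → Coprime d ∣ b ∣ → d ∣ ∣ U (suc n) ∣ → d ∣ ∣ U n ∣ → d ≡ 1
    coprime-consecutive zero    _     d∣u₁ _    = ∣1⇒≡1 d∣u₁
    coprime-consecutive (suc n) d⊥b d∣u₂ d∣u₁ = coprime-consecutive n d⊥b d∣u₁ d∣u₀
      where
      d∣bu₀ : _ ∣ ∣ b * U n ∣
      d∣bu₀ = ∣-+-cancelˡ (a * U (suc n)) (b * U n) d∣u₂ (∣-*ˡ a (U (suc n)) d∣u₁)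
      d∣u₀ : _ ∣ ∣ U n ∣
      d∣u₀ = coprime-divisor d⊥b (subst (_ ∣_) (abs-* b (U n)) d∣bu₀)

    coprime-u-suc : ∀ {m} n → Coprime m ∣ b ∣ → m ∣ ∣ U n ∣ → Coprime m ∣ U (suc n) ∣
    coprime-u-suc n m⊥b m∣uₙ (d∣m , d∣uₙ₊₁) =
      coprime-consecutive n (coprime-∣ m⊥b d∣m) d∣uₙ₊₁ (∣-trans d∣m m∣uₙ)

    rank∣⇒∣u : ∀ {m t n} → IsRank a b m t → t ∣ n → m ∣ ∣ U n ∣
    rank∣⇒∣u {t = t} (_ , m∣uₜ , _) (divides q refl) = ∣-trans m∣uₜ (u-∣-u-* a b t q)

    ∣u⇒rank∣ : ∀ {m t n} → IsRank a b m t → Coprime m ∣ b ∣ → m ∣ ∣ U n ∣ → t ∣ n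
    ∣u⇒rank∣ {m} {t@(suc _)} {n} rank@(_ , _ , minimal) m⊥b m∣uₙ =
      go (n % t) (n / t) (m≡m%n+[m/n]*n n t) (m%n<n n t)
      where
      go : ∀ r q → n ≡ r ℕ.+ q ℕ.* t → r < t → t ∣ n
      go zero     q n≡qt _   = divides q n≡qt
      go (suc r) q n≡r+qt r<t = contradiction m∣uᵣ (minimal (suc r) z<s r<t)
        where
        qt : ℕ
        qt = q ℕ.* t
        m∣u[qt] : m ∣ ∣ U qt ∣
        m∣u[qt] = rank∣⇒∣u rank (divides q refl)
        uₙ≡ : U n ≡ U (suc qt) * U (suc r) + b * U qt * U r
        uₙ≡ = trans (cong U (trans n≡r+qt (cong suc (ℕ.+-comm r qt)))) (u-+ a b qt r)
        m∣u[qt+1]uᵣ : m ∣ ∣ U (suc qt) * U (suc r) ∣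
        m∣u[qt+1]uᵣ = ∣-+-cancelʳ (U (suc qt) * U (suc r)) (b * U qt * U r)
          (subst (λ z → m ∣ ∣ z ∣) uₙ≡ m∣uₙ) (∣-*ʳ (b * U qt) (U r) (∣-*ˡ b (U qt) m∣u[qt]))
        m∣uᵣ : m ∣ ∣ U (suc r) ∣
        m∣uᵣ = coprime-divisor (coprime-u-suc qt m⊥b m∣u[qt]) (subst (m ∣_) (abs-* (U (suc qt)) (U (suc r))) m∣u[qt+1]uᵣ)
    ∣u⇒rank∣ {t = zero} (() , _) _ _

module Lifting where

  open import Data.Nat as ℕ using (ℕ; zero; suc; _≤_; _<_; z≤n; s≤s)
  import Data.Nat.Properties as ℕ
  open import Data.Nat.Combinatorics using (_C_)
  open import Data.Nat.Divisibility
  open import Data.Nat.Primality using (Prime)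
  import Data.Nat.Tactic.RingSolver as ℕ-Solver
  open import Data.Integer using (ℤ; +_; _+_; _-_; _*_; _^_; ∣_∣)
  open import Data.Integer.Properties using (abs-*)
  open import Data.Integer.Tactic.RingSolver using (solve-∀)
  open import Data.Product using (_,_)
  open import Data.Sum using (_⊎_; inj₁; inj₂; map₂)
  open import Relation.Nullary using (contradiction)
  open import Relation.Binary.PropositionalEquality
  open import Defs using (u; ν)
  open Valuation
  open AbsDivisibility
  open LucasSequence
  open Apparition

  module _ (a b : ℤ) {p} (p-prime : Prime p) (p∤b : p ∤ ∣ b ∣) where

    private
      U : ℕ → ℤ
      U = u a b

    p∣u⇒p∤u-suc : ∀ n → p ∣ ∣ U n ∣ → p ∤ ∣ U (suc n) ∣
    p∣u⇒p∤u-suc n p∣uₙ p∣uₙ₊₁ =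
      ℕ.>⇒≢ (prime>1 p-prime) (coprime-u-suc a b n (prime∤⇒coprime p-prime p∤b) p∣uₙ (∣-refl , p∣uₙ₊₁))

    private
      module Expansion {t e} (p^e∥x : p ^ e ∥ ∣ U (suc t) ∣) (0<e : 0 < e) where

        open Multiples a b t

        p∣x : p ∣ ∣ x ∣
        p∣x = ∣-trans (subst (_∣ p ℕ.^ e) (ℕ.^-identityʳ p) (^-monoʳ-∣ p 0<e)) (∥⇒∣ p^e∥x)

        p∤w : p ∤ ∣ w ∣
        p∤w = p∣u⇒p∤u-suc (suc t) p∣x

        p^[e+e]∣x² : p ℕ.^ (e ℕ.+ e) ∣ ∣ x * x ∣
        p^[e+e]∣x² = subst (_∣ ∣ x * x ∣) (sym (ℕ.^-distribˡ-+-* p e e))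
          (∣-*-pres x x (∥⇒∣ p^e∥x) (∥⇒∣ p^e∥x))

        1+e≤e+e : suc e ≤ e ℕ.+ e
        1+e≤e+e = subst (_≤ e ℕ.+ e) (ℕ.+-comm e 1) (ℕ.+-monoʳ-≤ e 0<e)

        p^[2+e]∣x³K : ∀ K → p ℕ.^ suc (suc e) ∣ ∣ x * x * x * K ∣
        p^[2+e]∣x³K K = ∣-*ʳ (x * x * x) K (subst (_∣ ∣ x * x * x ∣) (ℕ.*-comm (p ℕ.^ suc e) p)
          (∣-*-pres (x * x) x (∣-trans (^-monoʳ-∣ p 1+e≤e+e) p^[e+e]∣x²) p∣x))

        ∥-expansion : ∀ m {f} → f ≤ 1 → p ^ f ∥ m →
          p ℕ.^ suc (e ℕ.+ f) ∣ ∣ + (m C 2) * a * (x * x) ∣ → p ^ (e ℕ.+ f) ∥ ∣ U (m ℕ.* T) ∣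
        ∥-expansion m {f} f≤1 p^f∥m p^[1+e+f]∣C₂ax² with u-mT-expansion m
        ... | K , _ , w²u[mT]≡ , _ =
          ∥-cancelˡᶻ (w * w) (U (m ℕ.* T)) p-prime (∤-* w w p-prime p∤w p∤w)
            (subst (λ z → p ^ (e ℕ.+ f) ∥ ∣ z ∣) (sym (trans w²u[mT]≡ (regroup (+ m) (w ^ suc m) x C₂a (w ^ m) K)))
              (∥-+ (x * (+ m * w ^ suc m)) (x * x * x * K - w ^ m * (C₂a * (x * x))) p^[e+f]∥leading p^[1+e+f]∣rest))
          where
          C₂a : ℤ
          C₂a = + (m C 2) * a
          regroup : ∀ M V x c W K →
            M * V * x - c * W * (x * x) + x * x * x * K ≡ x * (M * V) + (x * x * x * K - W * (c * (x * x)))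
          regroup = solve-∀
          p^[e+f]∥leading : p ^ (e ℕ.+ f) ∥ ∣ x * (+ m * w ^ suc m) ∣
          p^[e+f]∥leading = subst (λ g → p ^ g ∥ ∣ x * (+ m * w ^ suc m) ∣) (cong (e ℕ.+_) (ℕ.+-identityʳ f))
            (∥-*ᶻ x (+ m * w ^ suc m) p-prime p^e∥x
              (∥-*ᶻ (+ m) (w ^ suc m) p-prime p^f∥m (∤⇒^0∥ (∤-^ w p-prime p∤w (suc m)))))
          p^[1+e+f]∣rest : p ℕ.^ suc (e ℕ.+ f) ∣ ∣ x * x * x * K - w ^ m * (C₂a * (x * x)) ∣
          p^[1+e+f]∣rest = ∣-− (x * x * x * K) (w ^ m * (C₂a * (x * x)))
            (∣-trans (^-monoʳ-∣ p (s≤s (ℕ.+-monoʳ-≤ e f≤1)))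
              (subst (λ g → p ℕ.^ suc g ∣ ∣ x * x * x * K ∣) (ℕ.+-comm 1 e) (p^[2+e]∣x³K K)))
            (∣-*ˡ (w ^ m) (C₂a * (x * x)) p^[1+e+f]∣C₂ax²)

    ∥-coprime-multiple : ∀ {T e} → p ^ e ∥ ∣ U T ∣ → 0 < e → ∀ m → p ∤ m → p ^ e ∥ ∣ U (m ℕ.* T) ∣
    ∥-coprime-multiple {zero} p^e∥0 _ _ _ = contradiction (_ ∣0) (∥⇒∤ p^e∥0)
    ∥-coprime-multiple {suc t} {e} p^e∥x 0<e m p∤m =
      subst (λ g → p ^ g ∥ ∣ U (m ℕ.* T) ∣) (ℕ.+-identityʳ e)
        (∥-expansion m z≤n (∤⇒^0∥ p∤m) (∣-*ˡ (+ (m C 2) * a) (x * x) p^[1+e]∣x²))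
      where
      open Expansion {t} p^e∥x 0<e
      open Multiples a b t using (T; x)
      p^[1+e]∣x² : p ℕ.^ suc (e ℕ.+ 0) ∣ ∣ x * x ∣
      p^[1+e]∣x² = ∣-trans (^-monoʳ-∣ p (subst (λ g → suc g ≤ e ℕ.+ e) (sym (ℕ.+-identityʳ e)) 1+e≤e+e)) p^[e+e]∣x²

    -- The condition on p, a and e makes the term C(p,2) a wᵖ x² of the expansion vanish modulo p^{e+2}.
    ∥-p-multiple : ∀ {T e} → p ^ e ∥ ∣ U T ∣ → 0 < e → p ∣ (p C 2) ℕ.* ∣ a ∣ ⊎ 2 ≤ e →
                   p ^ suc e ∥ ∣ U (p ℕ.* T) ∣
    ∥-p-multiple {zero} p^e∥0 _ _ = contradiction (_ ∣0) (∥⇒∤ p^e∥0)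
    ∥-p-multiple {suc t} {e} p^e∥x 0<e cond =
      subst (λ g → p ^ g ∥ ∣ U (p ℕ.* T) ∣) (ℕ.+-comm e 1) (∥-expansion p (s≤s z≤n) p^1∥p (p^[2+e]∣C₂ax² cond))
      where
      open Expansion {t} p^e∥x 0<e
      open Multiples a b t using (T; x)
      p^1∥p : p ^ 1 ∥ p
      p^1∥p = subst (p ^ 1 ∥_) (ℕ.^-identityʳ p) (^∥^ 1 (prime>1 p-prime))
      p^[2+e]∣C₂ax² : p ∣ (p C 2) ℕ.* ∣ a ∣ ⊎ 2 ≤ e → p ℕ.^ suc (e ℕ.+ 1) ∣ ∣ + (p C 2) * a * (x * x) ∣
      p^[2+e]∣C₂ax² (inj₁ p∣C₂a) =
        ∣-trans (*-monoʳ-∣ p (^-monoʳ-∣ p (ℕ.+-monoʳ-≤ e 0<e)))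
          (subst (p ℕ.* p ℕ.^ (e ℕ.+ e) ∣_) (sym (abs-* (+ (p C 2) * a) (x * x)))
            (*-pres-∣ (subst (p ∣_) (sym (abs-* (+ (p C 2)) a)) p∣C₂a) p^[e+e]∣x²))
      p^[2+e]∣C₂ax² (inj₂ 2≤e) = ∣-*ˡ (+ (p C 2) * a) (x * x)
        (∣-trans (^-monoʳ-∣ p (subst (_≤ e ℕ.+ e) (ℕ.+-suc e 1) (ℕ.+-monoʳ-≤ e 2≤e))) p^[e+e]∣x²)

    module _ {T e} (p^e∥u : p ^ e ∥ ∣ U T ∣) (0<e : 0 < e) (lifts : p ∣ (p C 2) ℕ.* ∣ a ∣ ⊎ 2 ≤ e) where

      private
        ∥-r*p^k-multiple : ∀ r k → p ∤ r → p ^ (e ℕ.+ k) ∥ ∣ U (r ℕ.* p ℕ.^ k ℕ.* T) ∣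
        ∥-r*p^k-multiple r zero p∤r =
          subst₂ (λ g n → p ^ g ∥ ∣ U n ∣) (sym (ℕ.+-identityʳ e)) (cong (ℕ._* T) (sym (ℕ.*-identityʳ r)))
            (∥-coprime-multiple p^e∥u 0<e r p∤r)
        ∥-r*p^k-multiple r (suc k) p∤r =
          subst₂ (λ g n → p ^ g ∥ ∣ U n ∣) (sym (ℕ.+-suc e k)) (reassoc p r (p ℕ.^ k) T)
            (∥-p-multiple (∥-r*p^k-multiple r k p∤r) (ℕ.≤-trans 0<e (ℕ.m≤m+n e k)) lifts′)
          where
          reassoc : ∀ p r P T → p ℕ.* (r ℕ.* P ℕ.* T) ≡ r ℕ.* (p ℕ.* P) ℕ.* T
          reassoc = ℕ-Solver.solve-∀
          lifts′ : p ∣ (p C 2) ℕ.* ∣ a ∣ ⊎ 2 ≤ e ℕ.+ k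
          lifts′ = map₂ (λ 2≤e → ℕ.≤-trans 2≤e (ℕ.m≤m+n e k)) lifts

      ∥-multiple : ∀ {m} → 0 < m → p ^ (e ℕ.+ ν p m) ∥ ∣ U (m ℕ.* T) ∣
      ∥-multiple {m} 0<m with ∥⇒cofactor (ν-∥ (prime>1 p-prime) 0<m)
      ... | r , m≡r*p^k , p∤r =
        subst (λ n → p ^ (e ℕ.+ ν p m) ∥ ∣ U (n ℕ.* T) ∣) (sym m≡r*p^k) (∥-r*p^k-multiple r (ν p m) p∤r)

module Parity where

  open import Data.Nat using (suc; _<_; s<s)
  open import Data.Nat.Divisibility
  open import Data.Nat.Primality using (prime[2])
  open import Data.Integer using (ℤ; +_; 0ℤ; 1ℤ; _+_; _*_; ∣_∣; _%ℕ_; _/ℕ_)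
  open import Data.Integer.DivMod using (n%ℕd<d; a≡a%ℕn+[a/ℕn]*n)
  open import Data.Integer.Tactic.RingSolver using (solve-∀)
  open import Data.Product using (∃-syntax; _,_)
  open import Data.Sum using (inj₁; inj₂)
  open import Relation.Nullary using (contradiction)
  open import Relation.Binary.PropositionalEquality
  open import Defs using (u; disc)
  open AbsDivisibility
  open LucasSequence

  odd⇒≡1+2i : ∀ x → 2 ∤ ∣ x ∣ → ∃[ i ] x ≡ 1ℤ + i * + 2
  odd⇒≡1+2i x 2∤x = go (x %ℕ 2) (x /ℕ 2) (a≡a%ℕn+[a/ℕn]*n x 2) (n%ℕd<d x 2)
    where
    go : ∀ r q → x ≡ + r + q * + 2 → r < 2 → ∃[ i ] x ≡ 1ℤ + i * + 2
    go 0 q x≡2q _ = contradiction (subst (λ y → 2 ∣ ∣ y ∣) (sym (trans x≡2q (0+y≡y (q * + 2)))) (∣-*ˡ q (+ 2) ∣-refl))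
                                  2∤x
      where
      0+y≡y : ∀ y → + 0 + y ≡ y
      0+y≡y = solve-∀
    go 1 q x≡1+2q _ = q , x≡1+2q
    go (suc (suc _)) _ _ (s<s (s<s ()))

  module _ (a b : ℤ) where

    private
      2∣4b : 2 ∣ ∣ + 4 * b ∣
      2∣4b = ∣-*ʳ (+ 4) b (divides 2 refl)

    2∣disc⇒2∣a : 2 ∣ ∣ disc a b ∣ → 2 ∣ ∣ a ∣
    2∣disc⇒2∣a 2∣Δ with prime∣* a a prime[2] (∣-+-cancelʳ (a * a) (+ 4 * b) 2∣Δ 2∣4b)
    ... | inj₁ 2∣a = 2∣a
    ... | inj₂ 2∣a = 2∣a

    2∣a⇒2∣disc : 2 ∣ ∣ a ∣ → 2 ∣ ∣ disc a b ∣
    2∣a⇒2∣disc 2∣a = ∣-+ (a * a) (+ 4 * b) (∣-*ʳ a a 2∣a) 2∣4b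

    2∣u₃ : 2 ∤ ∣ a ∣ → 2 ∤ ∣ b ∣ → 2 ∣ ∣ u a b 3 ∣
    2∣u₃ 2∤a 2∤b with odd⇒≡1+2i a 2∤a | odd⇒≡1+2i b 2∤b
    ... | i , refl | j , refl =
      subst (λ y → 2 ∣ ∣ y ∣) (sym (u₃≡ i j)) (∣-*ˡ (+ 2 * i * i + + 2 * i + j + 1ℤ) (+ 2) ∣-refl)
      where
      u₃≡ : ∀ i j → (1ℤ + i * + 2) * ((1ℤ + i * + 2) * 1ℤ + (1ℤ + j * + 2) * 0ℤ) + (1ℤ + j * + 2) * 1ℤ
                   ≡ (+ 2 * i * i + + 2 * i + j + 1ℤ) * + 2
      u₃≡ = solve-∀

    4∣u₆ : 2 ∤ ∣ a ∣ → 2 ∤ ∣ b ∣ → 4 ∣ ∣ u a b 6 ∣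
    4∣u₆ 2∤a 2∤b = subst (λ y → 4 ∣ ∣ y ∣) (sym (trans (u-mT≡u[T]*u′ 2) (cong (x *_) (u-2 a′ b′))))
      (∣-*-pres x a′ 2∣x 2∣a′)
      where
      open Multiples a b 2
      2∣x : 2 ∣ ∣ x ∣
      2∣x = 2∣u₃ 2∤a 2∤b
      regroup : ∀ a x y → a * x + y + y ≡ a * x + y * + 2
      regroup = solve-∀
      2∣a′ : 2 ∣ ∣ a′ ∣
      2∣a′ = subst (λ y → 2 ∣ ∣ y ∣) (sym (regroup a x (b * z)))
        (∣-+ (a * x) (b * z * + 2) (∣-*ˡ a x 2∣x) (∣-*ˡ (b * z) (+ 2) ∣-refl))

module PrimeValuation where

  open import Data.Nat as ℕ using (ℕ; zero; suc; _≤_; _<_; _∸_; z<s; _≟_)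
  import Data.Nat.Properties as ℕ
  open import Data.Nat.Combinatorics using (_C_)
  open import Data.Nat.Divisibility
  open import Data.Nat.Primality using (Prime; prime?; prime[2]; prime⇒irreducible; prime⇒nonZero; euclidsLemma)
  open import Data.Bool.Properties using (if-cong)
  open import Data.Integer using (ℤ; +_; _+_; _*_; _^_; ∣_∣)
  open import Data.Integer.Properties using (∣i∣≡0⇒i≡0)
  open import Data.Integer.Tactic.RingSolver using (solve-∀)
  open import Data.Product using (∃-syntax; _×_; _,_; proj₁; proj₂)
  open import Function using (id; _∘_; flip)
  open import Data.Sum using (inj₁; inj₂; [_,_]′)
  open import Relation.Nullary using (Dec; yes; no; contradiction)
  open import Relation.Nullary.Decidable using (dec-true; dec-false; from-yes; from-no)
  open import Relation.Binary.PropositionalEquality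
  open import Defs
  open Valuation
  open AbsDivisibility
  open LucasSequence
  open Apparition
  open Lifting
  open Frobenius using (prime∣pCk; odd-prime∣u⇒∣disc)
  open Parity

  module _ (a b : ℤ) (nondegenerate : NonDegenerate a b) (τ : ℕ → ℕ) (τ-rank : IsRankFn a b τ) where

    private
      U : ℕ → ℤ
      U = u a b
      Δ : ℤ
      Δ = disc a b

      quotient>0 : ∀ {n q t} → 0 < n → n ≡ q ℕ.* t → 0 < q
      quotient>0 {q = zero}  0<n n≡0 = contradiction n≡0 (ℕ.>⇒≢ 0<n)
      quotient>0 {q = suc _} _   _   = z<s

      ∸1+suc : ∀ {e} g → 0 < e → e ∸ 1 ℕ.+ suc g ≡ e ℕ.+ g
      ∸1+suc {suc e} g _ = ℕ.+-suc e g

    0<∣u∣ : ∀ n → 0 < n → 0 < ∣ U n ∣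
    0<∣u∣ n 0<n = ℕ.n≢0⇒n>0 (λ ∣uₙ∣≡0 → proj₂ (proj₂ nondegenerate) n 0<n (∣i∣≡0⇒i≡0 ∣uₙ∣≡0))

    module _ {p} (p-prime : Prime p) (p∤b : p ∤ ∣ b ∣) where

      private
        1<p : 1 < p
        1<p = prime>1 p-prime

      rank-prime : IsRank a b p (τ p)
      rank-prime = τ-rank p (ℕ.<⇒≤ 1<p) (prime∤⇒coprime p-prime p∤b)

      τ∣⇔∣u : ∀ {n} → (τ p ∣ n → p ∣ ∣ U n ∣) × (p ∣ ∣ U n ∣ → τ p ∣ n)
      τ∣⇔∣u = rank∣⇒∣u a b rank-prime , ∣u⇒rank∣ a b rank-prime (prime∤⇒coprime p-prime p∤b)

      0<ν[u[τ]] : 0 < ν p ∣ U (τ p) ∣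
      0<ν[u[τ]] = ∣⇒0<ν 1<p (0<∣u∣ (τ p) (proj₁ rank-prime)) (proj₁ (proj₂ rank-prime))

      τ≡p : p ∣ ∣ U p ∣ → τ p ≡ p
      τ≡p p∣uₚ with prime⇒irreducible p-prime (proj₂ τ∣⇔∣u p∣uₚ)
      ... | inj₂ τₚ≡p = τₚ≡p
      ... | inj₁ τ≡1 = contradiction (subst (λ t → p ∣ ∣ U t ∣) τ≡1 (proj₁ (proj₂ rank-prime))) (>⇒∤ 1<p)

      -- If τ(p) = s p, then u_{τ(p)} = u_s u′_p with u′ of discriminant Δ u_s² and p ∤ u_s, so p ∣ u′_p gives p ∣ Δ.
      p∤τ : p ≢ 2 → p ∤ ∣ Δ ∣ → p ∤ τ p
      p∤τ p≢2 p∤Δ (divides zero τ≡0) = contradiction τ≡0 (ℕ.>⇒≢ (proj₁ rank-prime))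
      p∤τ p≢2 p∤Δ (divides s@(suc s′) τ≡sp) = [ p∤x , p∤u′ₚ ]′ (prime∣* x (u a′ b′ p) p-prime p∣x*u′ₚ)
        where
        open Multiples a b s′
        p∣x*u′ₚ : p ∣ ∣ x * u a′ b′ p ∣
        p∣x*u′ₚ = subst (λ y → p ∣ ∣ y ∣) (trans (cong U (trans τ≡sp (ℕ.*-comm s p))) (u-mT≡u[T]*u′ p))
                    (proj₁ (proj₂ rank-prime))
        p∤x : p ∤ ∣ x ∣
        p∤x = proj₂ (proj₂ rank-prime) s z<s (subst (s <_) (sym τ≡sp) (ℕ.m<m*n s p 1<p))
        p∤u′ₚ : p ∤ ∣ u a′ b′ p ∣
        p∤u′ₚ p∣u′ₚ = [ p∤Δ , ∤-* x x p-prime p∤x p∤x ]′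
          (prime∣* Δ (x * x) p-prime
            (subst (λ y → p ∣ ∣ y ∣) disc-multiple (odd-prime∣u⇒∣disc a′ b′ p-prime p≢2 p∣u′ₚ)))

      ∥-u[τ] : p ^ ν p ∣ U (τ p) ∣ ∥ ∣ U (τ p) ∣
      ∥-u[τ] = ν-∥ 1<p (0<∣u∣ (τ p) (proj₁ rank-prime))

      ∥-odd-∤disc : p ≢ 2 → p ∤ ∣ Δ ∣ → ∀ {n} → 0 < n → τ p ∣ n → p ^ (ϱ a b τ p n ℕ.+ ν p n) ∥ ∣ U n ∣
      ∥-odd-∤disc p≢2 p∤Δ {n} 0<n (divides q n≡qτ) =
        subst₂ (λ g m → p ^ g ∥ ∣ U m ∣) (sym exponent) (sym n≡qτ)
          (∥-multiple a b p-prime p∤b ∥-u[τ] 0<ν[u[τ]] (inj₁ p∣C₂a) 0<q)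
        where
        0<q : 0 < q
        0<q = quotient>0 0<n n≡qτ
        p∣C₂a : p ∣ (p C 2) ℕ.* ∣ a ∣
        p∣C₂a = ∣m⇒∣m*n ∣ a ∣ (prime∣pCk p-prime z<s (odd-prime>2 p-prime p≢2))
        exponent : ϱ a b τ p n ℕ.+ ν p n ≡ ν p ∣ U (τ p) ∣ ℕ.+ ν p q
        exponent = cong₂ ℕ._+_
          (trans (if-cong (dec-false (p ≟ 2) p≢2)) (if-cong (dec-false (p ∣? ∣ Δ ∣) p∤Δ)))
          (trans (cong (ν p) n≡qτ) (ν[m*n]≡ν[m] p-prime 0<q (proj₁ rank-prime) (p∤τ p≢2 p∤Δ)))

      module _ (p≢2 : p ≢ 2) (p∣Δ : p ∣ ∣ Δ ∣) where

        private
          p∤2 : p ∤ 2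
          p∤2 = >⇒∤ (odd-prime>2 p-prime p≢2)

          p∤a : p ∤ ∣ a ∣
          p∤a p∣a = [ [ p∤2 , p∤2 ]′ ∘ euclidsLemma 2 2 p-prime , p∤b ]′
            (prime∣* (+ 4) b p-prime (∣-+-cancelˡ (a * a) (+ 4 * b) p∣Δ (∣-*ʳ a a p∣a)))

          W : ℤ
          W = a * a * (+ 2) ^ ℕ.pred p

          p∤W : p ∤ ∣ W ∣
          p∤W = ∤-* (a * a) ((+ 2) ^ ℕ.pred p) p-prime (∤-* a a p-prime p∤a p∤a) (∤-^ (+ 2) p-prime p∤2 (ℕ.pred p))

          expansion : ∃[ H ] W * U p ≡ + p * a ^ suc p + + (p C 3) * a ^ ℕ.pred p * Δ + H * (Δ * Δ)
          expansion = subst (λ m → ∃[ H ] W * U m ≡ + m * a ^ suc m + + (m C 3) * a ^ ℕ.pred p * Δ + H * (Δ * Δ))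
            (ℕ.suc-pred p {{prime⇒nonZero p-prime}}) (a²2ⁿu-expansion a b (ℕ.pred p))

          p∣uₚ : p ∣ ∣ U p ∣
          p∣uₚ with expansion
          ... | H , Wuₚ≡ = [ flip contradiction p∤W , id ]′ (prime∣* W (U p) p-prime (subst (λ y → p ∣ ∣ y ∣) (sym Wuₚ≡)
            (∣-+ (+ p * a ^ suc p + + (p C 3) * a ^ ℕ.pred p * Δ) (H * (Δ * Δ))
              (∣-+ (+ p * a ^ suc p) (+ (p C 3) * a ^ ℕ.pred p * Δ)
                (∣-*ʳ (+ p) (a ^ suc p) ∣-refl) (∣-*ˡ (+ (p C 3) * a ^ ℕ.pred p) Δ p∣Δ))
              (∣-*ˡ H (Δ * Δ) (∣-*ʳ Δ Δ p∣Δ)))))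

          p^1∥uₚ : p ≢ 3 → p ^ 1 ∥ ∣ U p ∣
          p^1∥uₚ p≢3 with expansion
          ... | H , Wuₚ≡ = ∥-cancelˡᶻ W (U p) p-prime p∤W
            (subst (λ y → p ^ 1 ∥ ∣ y ∣) (sym (trans Wuₚ≡ (+-assoc (+ p * a ^ suc p) B (H * (Δ * Δ)))))
              (∥-+ (+ p * a ^ suc p) (B + H * (Δ * Δ)) p^1∥leading
                (subst (_∣ ∣ B + H * (Δ * Δ) ∣) (cong (p ℕ.*_) (sym (ℕ.*-identityʳ p)))
                  (∣-+ B (H * (Δ * Δ)) (∣-*-pres (+ (p C 3) * a ^ ℕ.pred p) Δ p∣C₃a p∣Δ)
                    (∣-*ˡ H (Δ * Δ) (∣-*-pres Δ Δ p∣Δ p∣Δ))))))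
            where
            B : ℤ
            B = + (p C 3) * a ^ ℕ.pred p * Δ
            +-assoc : ∀ x y z → x + y + z ≡ x + (y + z)
            +-assoc = solve-∀
            p^1∥leading : p ^ 1 ∥ ∣ + p * a ^ suc p ∣
            p^1∥leading = ∥-*ᶻ (+ p) (a ^ suc p) p-prime (subst (p ^ 1 ∥_) (ℕ.^-identityʳ p) (^∥^ 1 1<p))
              (∤⇒^0∥ (∤-^ a p-prime p∤a (suc p)))
            p∣C₃a : p ∣ ∣ + (p C 3) * a ^ ℕ.pred p ∣
            p∣C₃a = ∣-*ʳ (+ (p C 3)) (a ^ ℕ.pred p)
              (prime∣pCk p-prime z<s (ℕ.≤∧≢⇒< (odd-prime>2 p-prime p≢2) (≢-sym p≢3)))

        ∥-odd-∣disc : ∀ {n} → 0 < n → τ p ∣ n → p ^ (ϱ a b τ p n ℕ.+ ν p n) ∥ ∣ U n ∣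
        ∥-odd-∣disc {n} 0<n (divides q n≡qτ) =
          subst₂ (λ g m → p ^ g ∥ ∣ U m ∣) (sym exponent) (sym n≡qp)
            (∥-multiple a b p-prime p∤b p^e∥uₚ 0<e (inj₁ p∣C₂a) 0<q)
          where
          e : ℕ
          e = ν p ∣ U p ∣
          p^e∥uₚ : p ^ e ∥ ∣ U p ∣
          p^e∥uₚ = ν-∥ 1<p (0<∣u∣ p (ℕ.<-trans z<s 1<p))
          0<e : 0 < e
          0<e = ∣⇒0<ν 1<p (0<∣u∣ p (ℕ.<-trans z<s 1<p)) p∣uₚ
          p∣C₂a : p ∣ (p C 2) ℕ.* ∣ a ∣
          p∣C₂a = ∣m⇒∣m*n ∣ a ∣ (prime∣pCk p-prime z<s (odd-prime>2 p-prime p≢2))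
          n≡qp : n ≡ q ℕ.* p
          n≡qp = trans n≡qτ (cong (q ℕ.*_) (τ≡p p∣uₚ))
          0<q : 0 < q
          0<q = quotient>0 0<n n≡qp
          ν[n]≡1+ν[q] : ν p n ≡ suc (ν p q)
          ν[n]≡1+ν[q] = trans (cong (ν p) n≡qp) (ν[m*p]≡1+ν[m] p-prime 0<q)
          exponent : ϱ a b τ p n ℕ.+ ν p n ≡ e ℕ.+ ν p q
          exponent with p ≟ 3
          ... | yes p≡3 = trans (cong₂ ℕ._+_ (ϱ-3 p≡3) ν[n]≡1+ν[q]) (∸1+suc (ν p q) 0<e)
            where
            ϱ-3 : p ≡ 3 → ϱ a b τ p n ≡ e ∸ 1
            ϱ-3 refl = if-cong (dec-true (3 ∣? ∣ Δ ∣) p∣Δ)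
          ... | no p≢3 = trans (cong₂ ℕ._+_ ϱ≡0 ν[n]≡1+ν[q])
            (cong (ℕ._+ ν p q) (sym (∥-unique p^e∥uₚ (p^1∥uₚ p≢3))))
            where
            ϱ≡0 : ϱ a b τ p n ≡ 0
            ϱ≡0 = trans (if-cong (dec-false (p ≟ 2) p≢2))
                    (trans (if-cong (dec-true (p ∣? ∣ Δ ∣) p∣Δ)) (if-cong (dec-false (p ≟ 3) p≢3)))

    module _ (2∤b : 2 ∤ ∣ b ∣) where

      private
        1<2 : 1 < 2
        1<2 = prime>1 prime[2]

      ∥-2-∣disc : 2 ∣ ∣ Δ ∣ → ∀ {n} → 0 < n → τ 2 ∣ n → 2 ^ (ϱ a b τ 2 n ℕ.+ ν 2 n) ∥ ∣ U n ∣
      ∥-2-∣disc 2∣Δ {n} 0<n (divides q n≡qτ) =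
        subst₂ (λ g m → 2 ^ g ∥ ∣ U m ∣) (sym exponent) (sym n≡q2)
          (∥-multiple a b prime[2] 2∤b 2^e∥u₂ 0<e (inj₁ (∣n⇒∣m*n (2 C 2) 2∣a)) 0<q)
        where
        2∣a : 2 ∣ ∣ a ∣
        2∣a = 2∣disc⇒2∣a a b 2∣Δ
        2∣u₂ : 2 ∣ ∣ U 2 ∣
        2∣u₂ = subst (λ y → 2 ∣ ∣ y ∣) (sym (u-2 a b)) 2∣a
        e : ℕ
        e = ν 2 ∣ U 2 ∣
        2^e∥u₂ : 2 ^ e ∥ ∣ U 2 ∣
        2^e∥u₂ = ν-∥ 1<2 (0<∣u∣ 2 z<s)
        0<e : 0 < e
        0<e = ∣⇒0<ν 1<2 (0<∣u∣ 2 z<s) 2∣u₂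
        n≡q2 : n ≡ q ℕ.* 2
        n≡q2 = trans n≡qτ (cong (q ℕ.*_) (τ≡p prime[2] 2∤b 2∣u₂))
        0<q : 0 < q
        0<q = quotient>0 0<n n≡q2
        exponent : ϱ a b τ 2 n ℕ.+ ν 2 n ≡ e ℕ.+ ν 2 q
        exponent = trans (cong₂ ℕ._+_ (if-cong (dec-true (2 ∣? ∣ Δ ∣) 2∣Δ))
                                      (trans (cong (ν 2) n≡q2) (ν[m*p]≡1+ν[m] prime[2] 0<q)))
                         (∸1+suc (ν 2 q) 0<e)

      module _ (2∤Δ : 2 ∤ ∣ Δ ∣) where

        private
          2∤a : 2 ∤ ∣ a ∣
          2∤a = 2∤Δ ∘ 2∣a⇒2∣disc a b

          ϱ-odd : ∀ {n} → 2 ∤ n → ϱ a b τ 2 n ≡ ν 2 ∣ U 3 ∣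
          ϱ-odd {n} 2∤n = trans (if-cong (dec-false (2 ∣? ∣ Δ ∣) 2∤Δ)) (if-cong (dec-false (2 ∣? n) 2∤n))

          ϱ-even : ∀ {n} → 2 ∣ n → ϱ a b τ 2 n ≡ ν 2 ∣ U 6 ∣ ∸ 1
          ϱ-even {n} 2∣n = trans (if-cong (dec-false (2 ∣? ∣ Δ ∣) 2∤Δ)) (if-cong (dec-true (2 ∣? n) 2∣n))

          τ≡3 : τ 2 ≡ 3
          τ≡3 with prime⇒irreducible (from-yes (prime? 3)) (proj₂ (τ∣⇔∣u prime[2] 2∤b) (2∣u₃ a b 2∤a 2∤b))
          ... | inj₂ τ₂≡3 = τ₂≡3
          ... | inj₁ τ≡1 = contradiction (subst (λ t → 2 ∣ ∣ U t ∣) τ≡1 (proj₁ (proj₂ (rank-prime prime[2] 2∤b))))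
                                         (>⇒∤ 1<2)

          ∥-odd-multiple : ∀ q → 0 < q → 2 ∤ q → 2 ^ (ϱ a b τ 2 (q ℕ.* 3) ℕ.+ ν 2 (q ℕ.* 3)) ∥ ∣ U (q ℕ.* 3) ∣
          ∥-odd-multiple q 0<q 2∤q =
            subst (λ g → 2 ^ g ∥ ∣ U (q ℕ.* 3) ∣) (sym exponent)
              (∥-coprime-multiple a b prime[2] 2∤b (ν-∥ 1<2 (0<∣u∣ 3 z<s)) 0<e q 2∤q)
            where
            0<e : 0 < ν 2 ∣ U 3 ∣
            0<e = ∣⇒0<ν 1<2 (0<∣u∣ 3 z<s) (2∣u₃ a b 2∤a 2∤b)
            2∤3q : 2 ∤ q ℕ.* 3
            2∤3q 2∣3q = [ 2∤q , (λ 2∣3 → contradiction 2∣3 (from-no (2 ∣? 3))) ]′ (euclidsLemma q 3 prime[2] 2∣3q)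
            exponent : ϱ a b τ 2 (q ℕ.* 3) ℕ.+ ν 2 (q ℕ.* 3) ≡ ν 2 ∣ U 3 ∣
            exponent = trans (cong₂ ℕ._+_ (ϱ-odd 2∤3q) (ν≡0 1<2 (ℕ.*-mono-≤ 0<q z<s) 2∤3q))
                             (ℕ.+-identityʳ (ν 2 ∣ U 3 ∣))

          ∥-even-multiple : ∀ q → 0 < q → 2 ^ (ϱ a b τ 2 (q ℕ.* 6) ℕ.+ ν 2 (q ℕ.* 6)) ∥ ∣ U (q ℕ.* 6) ∣
          ∥-even-multiple q 0<q =
            subst (λ g → 2 ^ g ∥ ∣ U (q ℕ.* 6) ∣) (sym exponent)
              (∥-multiple a b prime[2] 2∤b 2^e∥u₆ (ℕ.<-trans z<s 2≤e) (inj₂ 2≤e) 0<q)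
            where
            e : ℕ
            e = ν 2 ∣ U 6 ∣
            2^e∥u₆ : 2 ^ e ∥ ∣ U 6 ∣
            2^e∥u₆ = ν-∥ 1<2 (0<∣u∣ 6 z<s)
            2≤e : 2 ≤ e
            2≤e = ∥⇒≤ 2^e∥u₆ (4∣u₆ a b 2∤a 2∤b)
            ν[6q]≡1+ν[q] : ν 2 (q ℕ.* 6) ≡ suc (ν 2 q)
            ν[6q]≡1+ν[q] = trans (ν-* prime[2] 0<q z<s) (ℕ.+-comm (ν 2 q) 1)
            exponent : ϱ a b τ 2 (q ℕ.* 6) ℕ.+ ν 2 (q ℕ.* 6) ≡ e ℕ.+ ν 2 q
            exponent = trans (cong₂ ℕ._+_ (ϱ-even (∣n⇒∣m*n q (divides 3 refl))) ν[6q]≡1+ν[q])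
                             (∸1+suc (ν 2 q) (ℕ.<-trans z<s 2≤e))

        ∥-2-∤disc : ∀ {n} → 0 < n → τ 2 ∣ n → 2 ^ (ϱ a b τ 2 n ℕ.+ ν 2 n) ∥ ∣ U n ∣
        ∥-2-∤disc {n} 0<n (divides q n≡qτ) with 2 ∣? q
        ... | no 2∤q = subst (λ m → 2 ^ (ϱ a b τ 2 m ℕ.+ ν 2 m) ∥ ∣ U m ∣) (sym n≡q3)
          (∥-odd-multiple q (quotient>0 0<n n≡q3) 2∤q)
          where
          n≡q3 : n ≡ q ℕ.* 3
          n≡q3 = trans n≡qτ (cong (q ℕ.*_) τ≡3)
        ... | yes (divides q′ refl) = subst (λ m → 2 ^ (ϱ a b τ 2 m ℕ.+ ν 2 m) ∥ ∣ U m ∣) (sym n≡q′6)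
          (∥-even-multiple q′ (quotient>0 0<n n≡q′6))
          where
          n≡q′6 : n ≡ q′ ℕ.* 6
          n≡q′6 = trans n≡qτ (trans (cong (q′ ℕ.* 2 ℕ.*_) τ≡3) (ℕ.*-assoc q′ 2 3))

    ∥-prime : ∀ {p n} → Prime p → p ∤ ∣ b ∣ → 0 < n → τ p ∣ n → p ^ (ϱ a b τ p n ℕ.+ ν p n) ∥ ∣ U n ∣
    ∥-prime {p} {n} p-prime p∤b = cases (p ≟ 2) (p ∣? ∣ Δ ∣)
      where
      cases : Dec (p ≡ 2) → Dec (p ∣ ∣ Δ ∣) → 0 < n → τ p ∣ n → p ^ (ϱ a b τ p n ℕ.+ ν p n) ∥ ∣ U n ∣
      cases (yes refl) (yes 2∣Δ) = ∥-2-∣disc p∤b 2∣Δ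
      cases (yes refl) (no  2∤Δ) = ∥-2-∤disc p∤b 2∤Δ
      cases (no  p≢2)  (yes p∣Δ) = ∥-odd-∣disc p-prime p∤b p≢2 p∣Δ
      cases (no  p≢2)  (no  p∤Δ) = ∥-odd-∤disc p-prime p∤b p≢2 p∤Δ

module PrimeProducts where

  open import Data.Nat
  open import Data.Nat.Properties
  open import Data.Nat.Divisibility
  open import Data.Nat.Primality
  open import Data.Product using (_×_; _,_)
  open import Data.Sum using (_⊎_; inj₁; inj₂; [_,_]′)
  open import Relation.Nullary using (¬_; yes; no; contradiction)
  open import Relation.Binary.PropositionalEquality
  open import Defs using (primeProd; rad)
  open Valuation

  private
    primeProd-suc : ∀ k f i →
      (Prime i × i ∣ k × primeProd k f (suc i) ≡ f i * primeProd k f i)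
      ⊎ (¬ (Prime i × i ∣ k) × primeProd k f (suc i) ≡ primeProd k f i)
    primeProd-suc k f i with prime? i | i ∣? k
    ... | yes i-prime | yes i∣k = inj₁ (i-prime , i∣k , refl)
    ... | yes _       | no  i∤k = inj₂ ((λ (_ , i∣k) → i∤k i∣k) , refl)
    ... | no  ¬prime  | _       = inj₂ ((λ (i-prime , _) → ¬prime i-prime) , refl)

  0<primeProd : ∀ k f i → (∀ {q} → Prime q → 0 < f q) → 0 < primeProd k f i
  0<primeProd k f zero    _     = z<s
  0<primeProd k f (suc i) 0<f with primeProd-suc k f i
  ... | inj₁ (i-prime , _ , eq) = subst (0 <_) (sym eq) (*-mono-≤ (0<f i-prime) (0<primeProd k f i 0<f))
  ... | inj₂ (_ , eq)           = subst (0 <_) (sym eq) (0<primeProd k f i 0<f)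

  ∤-primeProd : ∀ {p} k f i → Prime p → (∀ {q} → Prime q → q ∣ k → q < i → p ∤ f q) → p ∤ primeProd k f i
  ∤-primeProd k f zero    p-prime _ p∣1 = contradiction (∣1⇒≡1 p∣1) (>⇒≢ (prime>1 p-prime))
  ∤-primeProd k f (suc i) p-prime p∤f with primeProd-suc k f i
  ... | inj₁ (i-prime , i∣k , eq) = λ p∣fP →
    [ p∤f i-prime i∣k ≤-refl , p∤P ]′ (euclidsLemma (f i) (primeProd k f i) p-prime (subst (_ ∣_) eq p∣fP))
    where
    p∤P : _ ∤ primeProd k f i
    p∤P = ∤-primeProd k f i p-prime (λ q-prime q∣k q<i → p∤f q-prime q∣k (m<n⇒m<1+n q<i))
  ... | inj₂ (_ , eq) = λ p∣P →
    ∤-primeProd k f i p-prime (λ q-prime q∣k q<i → p∤f q-prime q∣k (m<n⇒m<1+n q<i)) (subst (_ ∣_) eq p∣P)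

  ∥-primeProd : ∀ {p ρ} k f i → Prime p → p ∣ k → p < i → p ^ ρ ∥ f p →
    (∀ {q} → Prime q → q ∣ k → q ≢ p → p ∤ f q) → p ^ ρ ∥ primeProd k f i
  ∥-primeProd {p} {ρ} k f (suc i) p-prime p∣k p<1+i p^ρ∥fp p∤f with primeProd-suc k f i | i ≟ p
  ... | inj₁ (_ , _ , eq) | yes refl = subst₂ (λ e m → p ^ e ∥ m) (+-identityʳ ρ) (sym eq)
    (∥-* p-prime p^ρ∥fp (∤⇒^0∥ (∤-primeProd k f p p-prime (λ q-prime q∣k q<p → p∤f q-prime q∣k (<⇒≢ q<p)))))
  ... | inj₁ (i-prime , i∣k , eq) | no i≢p = subst (p ^ ρ ∥_) (sym eq)
    (∥-* p-prime (∤⇒^0∥ (p∤f i-prime i∣k i≢p)) (∥-primeProd k f i p-prime p∣k p<i p^ρ∥fp p∤f))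
    where
    p<i : p < i
    p<i = ≤∧≢⇒< (≤-pred p<1+i) (≢-sym i≢p)
  ... | inj₂ (¬i-prime∣k , eq) | yes refl = contradiction (p-prime , p∣k) ¬i-prime∣k
  ... | inj₂ (_ , eq) | no i≢p = subst (p ^ ρ ∥_) (sym eq) (∥-primeProd k f i p-prime p∣k p<i p^ρ∥fp p∤f)
    where
    p<i : p < i
    p<i = ≤∧≢⇒< (≤-pred p<1+i) (≢-sym i≢p)

  private
    p<1+k : ∀ {p k} → 0 < k → p ∣ k → p < suc k
    p<1+k 0<k p∣k = s≤s (∣⇒≤ {{>-nonZero 0<k}} p∣k)

  ∥-primeProd-^ : ∀ {p} k (g : ℕ → ℕ) → 0 < k → Prime p → p ∣ k → p ^ g p ∥ primeProd k (λ q → q ^ g q) (suc k)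
  ∥-primeProd-^ {p} k g 0<k p-prime p∣k = ∥-primeProd k (λ q → q ^ g q) (suc k) p-prime p∣k (p<1+k 0<k p∣k)
    (^∥^ (g p) (prime>1 p-prime))
    (λ {q} q-prime _ q≢p p∣q^g → q≢p (sym (prime∣prime⇒≡ p-prime q-prime (prime∣^⇒∣ (g q) p-prime p∣q^g))))

  0<primeProd-^ : ∀ k (g : ℕ → ℕ) → 0 < primeProd k (λ q → q ^ g q) (suc k)
  0<primeProd-^ k g = 0<primeProd k (λ q → q ^ g q) (suc k) (λ {q} q-prime → m^n>0 q {{prime⇒nonZero q-prime}} (g q))

  ∥-rad : ∀ {p k} → 0 < k → Prime p → p ∣ k → p ^ 1 ∥ rad k
  ∥-rad {p} {k} 0<k p-prime p∣k = ∥-primeProd k (λ q → q) (suc k) p-prime p∣k (p<1+k 0<k p∣k)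
    (subst (p ^ 1 ∥_) (^-identityʳ p) (^∥^ 1 (prime>1 p-prime)))
    (λ q-prime _ q≢p p∣q → q≢p (sym (prime∣prime⇒≡ p-prime q-prime p∣q)))

  ∣⇒∣rad : ∀ {p k} → 0 < k → Prime p → p ∣ k → p ∣ rad k
  ∣⇒∣rad {p} 0<k p-prime p∣k = subst (_∣ _) (^-identityʳ p) (∥⇒∣ (∥-rad 0<k p-prime p∣k))

  0<rad : ∀ k → 0 < rad k
  0<rad k = 0<primeProd k (λ q → q) (suc k) (λ q-prime → <-trans z<s (prime>1 q-prime))

  rad∣k : ∀ {k} → 0 < k → rad k ∣ k
  rad∣k {k} 0<k = ∣-from-prime-powers (0<rad k) powers
    where
    powers : ∀ {q} j → Prime q → q ^ j ∣ rad k → q ^ j ∣ k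
    powers zero _ _ = 1∣ k
    powers {q} (suc j) q-prime q^j+1∣rad with q ∣? k
    ... | yes q∣k = ∣-trans (^-monoʳ-∣ q (∥⇒≤ {j = suc j} (∥-rad 0<k q-prime q∣k) q^j+1∣rad))
                            (subst (_∣ k) (sym (^-identityʳ q)) q∣k)
    ... | no  q∤k = contradiction (∣-trans (m∣m*n (q ^ j)) q^j+1∣rad)
      (∤-primeProd k (λ q → q) (suc k) q-prime
        (λ q′-prime q′∣k _ q∣q′ → q∤k (subst (_∣ k) (sym (prime∣prime⇒≡ q-prime q′-prime q∣q′)) q′∣k)))


open import Data.Nat using (ℕ; _+_; _*_; _≤_; _<_; z<s)
open import Data.Nat.Properties using (*-mono-≤; <-trans; >⇒≢)
open import Data.Nat.Divisibility using (_∣_; _∤_; ∣-trans)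
open import Data.Nat.Coprimality using (Coprime)
open import Data.Nat.Primality using (Prime)
open import Data.Integer using (ℤ; ∣_∣)
open import Data.Product using (∃-syntax; _×_; _,_; proj₂)
open import Relation.Nullary using (¬_)
open import Relation.Binary.PropositionalEquality using (_≡_)
open import Defs
open Valuation
open Apparition
open PrimeProducts
open PrimeValuation

theorem1p6 : (a b : ℤ) → NonDegenerate a b →
    (τ : ℕ → ℕ) → IsRankFn a b τ →
    (k : ℕ) → 2 ≤ k → Coprime k ∣ b ∣ →
    (n : ℕ) → 1 ≤ n →
    (τ (rad k) ∣ n → ν k ∣ u a b n ∣ ≡ ν k (c a b τ k n * n))
    × (¬ (τ (rad k) ∣ n) → ν k ∣ u a b n ∣ ≡ 0)
theorem1p6 a b nondegenerate τ τ-rank k 1<k k⊥b n 0<n = τ∣n⇒ν≡ , τ∤n⇒ν≡0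
  where
  0<k : 0 < k
  0<k = <-trans z<s 1<k
  rad⊥b : Coprime (rad k) ∣ b ∣
  rad⊥b = coprime-∣ k⊥b (rad∣k 0<k)
  rad-rank : IsRank a b (rad k) (τ (rad k))
  rad-rank = τ-rank (rad k) (0<rad k) rad⊥b
  p∤b : ∀ {p} → Prime p → p ∣ k → p ∤ ∣ b ∣
  p∤b p-prime p∣k p∣b = >⇒≢ (prime>1 p-prime) (k⊥b (p∣k , p∣b))
  τ∤n⇒ν≡0 : ¬ (τ (rad k) ∣ n) → ν k ∣ u a b n ∣ ≡ 0
  τ∤n⇒ν≡0 τ∤n = ν≡0 1<k (0<∣u∣ a b nondegenerate τ τ-rank n 0<n)
    (λ k∣u → τ∤n (∣u⇒rank∣ a b rad-rank rad⊥b (∣-trans (rad∣k 0<k) k∣u)))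
  τ∣n⇒ν≡ : τ (rad k) ∣ n → ν k ∣ u a b n ∣ ≡ ν k (c a b τ k n * n)
  τ∣n⇒ν≡ τ∣n =
    ν-≡-primewise 1<k (0<∣u∣ a b nondegenerate τ τ-rank n 0<n) (*-mono-≤ (0<primeProd-^ k ϱₙ) 0<n) agree
    where
    ϱₙ : ℕ → ℕ
    ϱₙ p = ϱ a b τ p n
    agree : ∀ {p} → Prime p → p ∣ k → ∃[ e ] p ^ e ∥ ∣ u a b n ∣ × p ^ e ∥ c a b τ k n * n
    agree {p} p-prime p∣k = ϱₙ p + ν p n
      , ∥-prime a b nondegenerate τ τ-rank p-prime (p∤b p-prime p∣k) 0<n τₚ∣n
      , ∥-* p-prime (∥-primeProd-^ k ϱₙ 0<k p-prime p∣k) (ν-∥ (prime>1 p-prime) 0<n)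
      where
      τₚ∣n : τ p ∣ n
      τₚ∣n = proj₂ (τ∣⇔∣u a b nondegenerate τ τ-rank p-prime (p∤b p-prime p∣k))
        (∣-trans (∣⇒∣rad 0<k p-prime p∣k) (rank∣⇒∣u a b rad-rank τ∣n))
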